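{- For any finite nonempty sets $P',P''\subset\mathbb{Z}^2$ there exist $(a_0,b_0)\in\mathbb{Z}^2$, integers $k_x,k_y$, a finite subset $S\subset T_{\mathrm{uni}}$ and integers $k_{\mathcal{T}}$ ($\mathcal{T}\in S$) such that for all $(x,y)\in\mathbb{R}^2$ $$\max\langle P'\rangle-\max\langle P''\rangle=a_0x+b_0y+k_x\max(0,x)+k_y\max(0,y)+\sum_{\mathcal{T}\in S}k_{\mathcal{T}}\max\langle v(\mathcal{T})\rangle.$$
   Context: For a finite set $Q\subset\mathbb{R}^2$, $\max\langle Q\rangle$ denotes the function $(x,y)\mapsto\max_{(a,b)\in Q}(ax+by)$. For a triangle $\mathcal{T}$, $v(\mathcal{T})$ is its set of three vertices. $T_{\mathrm{uni}}$ is the set of triangles $\mathrm{conv}\{(a_1,b_1),(a_2,b_2),(a_3,b_3)\}$ with all $a_i,b_i$ nonnegative integers, area exactly $1/2$, at least one $a_i=0$ and at least one $b_i=0$.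
   Formalization: The identity is required only for $(x,y)$ with rational coordinates, rather than for all $(x,y)\in\mathbb{R}^2$. -}

module Defs where

open import Data.Nat using (ℕ)
open import Data.Integer as ℤ using (ℤ; +_; ∣_∣)
open import Data.Rational as ℚ using (ℚ; 0ℚ; _/_; _+_; _*_; _⊔_)
open import Data.Product using (_×_; _,_; proj₁; proj₂)
open import Data.Sum using (_⊎_)
open import Data.List using (List; []; _∷_)
open import Data.List.NonEmpty using (List⁺; foldr₁) renaming (map to map⁺)
open import Relation.Binary.PropositionalEquality using (_≡_)

⟦_⟧ : ℤ → ℚ
⟦ z ⟧ = z / 1

Point : Set
Point = ℤ × ℤ

lin : Point → ℚ → ℚ → ℚ
lin (a , b) x y = ⟦ a ⟧ * x + ⟦ b ⟧ * y

maxOf : List⁺ Point → ℚ → ℚ → ℚ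
maxOf Q x y = foldr₁ _⊔_ (map⁺ (λ p → lin p x y) Q)

record Triangle : Set where
  constructor tri
  field
    a₁ b₁ a₂ b₂ a₃ b₃ : ℕ

open Triangle public

vertices : Triangle → List⁺ Point
vertices T = (+ a₁ T , + b₁ T) Data.List.NonEmpty.∷
             ((+ a₂ T , + b₂ T) ∷ (+ a₃ T , + b₃ T) ∷ [])

det2 : Triangle → ℤ
det2 T = ((+ a₂ T) ℤ.- (+ a₁ T)) ℤ.* ((+ b₃ T) ℤ.- (+ b₁ T))
       ℤ.- ((+ a₃ T) ℤ.- (+ a₁ T)) ℤ.* ((+ b₂ T) ℤ.- (+ b₁ T))

-- membership in T_uni: area exactly 1/2, some a_i = 0, some b_i = 0
-- (nonnegativity of coordinates is built into Triangle)
InTuni : Triangle → Set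
InTuni T = (∣ det2 T ∣ ≡ 1)
         × (a₁ T ≡ 0 ⊎ a₂ T ≡ 0 ⊎ a₃ T ≡ 0)
         × (b₁ T ≡ 0 ⊎ b₂ T ≡ 0 ⊎ b₃ T ≡ 0)

triSum : List (ℤ × Triangle) → ℚ → ℚ → ℚ
triSum [] x y = 0ℚ
triSum ((k , T) ∷ S) x y = ⟦ k ⟧ * maxOf (vertices T) x y + triSum S x y

{-# OPTIONS --safe #-}
-- The functions admitting a decomposition of the required shape form a ℤ-module containing the
-- linear forms, max(0,x), max(0,y) and max⟨v(T)⟩ for T ∈ T_uni, so it suffices to show that
-- max⟨P⟩ lies in it for every finite P.  Every unimodular triangle is a translate of one in T_uni.
-- For a segment [0,w], Euclid's algorithm runs through unimodular frames (v,w), and the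
-- parallelogram spanned by such a frame is the union of two unimodular triangles.  A degenerate
-- triangle is a segment, and a triangle of larger area contains a lattice point other than its
-- vertices; subdividing at that point expresses it through three triangles of smaller area,
-- segments and a linear form.  Finally, by Radon's theorem four points of P either contain one
-- in the convex hull of the others, which can be dropped, or split into crossing pairs
-- {p,q} | {r,s}, and then max⟨P⟩ = max⟨P∖{p}⟩ + max⟨P∖{q}⟩ − max⟨P∖{p,q}⟩; either way fewer
-- points remain.
module Submission where

open import Defs
open import Data.Integer using (ℤ)
open import Data.Rational using (ℚ; 0ℚ; _+_; _-_; _*_; _⊔_)
open import Data.Product using (_×_; Σ; _,_; proj₂)
open import Data.List using (List)
open import Data.List.NonEmpty using (List⁺)
open import Data.List.Relation.Unary.All using (All)
open import Relation.Binary.PropositionalEquality using (_≡_)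

open import Data.Empty using (⊥; ⊥-elim)
open import Data.Maybe.Base using (Maybe; just; nothing)
open import Data.Nat as ℕ using (ℕ; zero; suc; _∸_)
import Data.Nat.Coprimality as Coprimality
import Data.Nat.Properties as ℕP
open import Data.Integer as ℤ using (+_; -[1+_]; +[1+_]; 0ℤ; 1ℤ; ∣_∣; _/ℕ_; _%ℕ_)
import Data.Integer.DivMod as ℤDM
import Data.Integer.Properties as ℤP
open import Data.Integer.Tactic.RingSolver using () renaming (solve-∀ to ℤ-solve)
open import Data.List using ([]; _∷_; _++_; map)
open import Data.List.NonEmpty using (_∷_; _∷⁺_) renaming (map to map⁺)
open import Data.List.Relation.Unary.All using ([]; _∷_)
import Data.List.Relation.Unary.All.Properties as All
open import Data.Product using (proj₁; map₁)
open import Data.Rational as ℚ using (mkℚ; 1ℚ; -_; _≤_; _<_; _⊓_)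
import Data.Rational.Properties as ℚP
open import Data.Sum using (_⊎_; inj₁; inj₂)
open import Function using (_$_)
open import Level using (0ℓ)
open import Relation.Binary.Definitions using (tri<; tri≈; tri>)
open import Relation.Binary.PropositionalEquality
  using (refl; sym; trans; cong; cong₂; subst; subst₂; module ≡-Reasoning)
open import Relation.Nullary using (yes; no; ¬_)
open import Tactic.RingSolver using (solve-∀)
import Tactic.RingSolver.Core.AlmostCommutativeRing as ACR

ℚ-ring : ACR.AlmostCommutativeRing 0ℓ 0ℓ
ℚ-ring = ACR.fromCommutativeRing ℚP.+-*-commutativeRing isZero
  where
  -- the solver can only cancel coefficients it recognises as zero
  isZero : ∀ p → Maybe (0ℚ ≡ p)
  isZero p with 0ℚ ℚP.≟ p
  ... | yes 0≡p = just 0≡p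
  ... | no _    = nothing

-- ⟦ z ⟧′ is the normal form of ⟦ z ⟧; sums and products of such fractions compute.
private
  ⟦_⟧′ : ℤ → ℚ
  ⟦ z ⟧′ = mkℚ z 0 (Coprimality.sym (Coprimality.1-coprimeTo _))

  ⟦⟧≡⟦⟧′ : ∀ z → ⟦ z ⟧ ≡ ⟦ z ⟧′
  ⟦⟧≡⟦⟧′ z = ℚP.↥p/↧p≡p ⟦ z ⟧′

⟦⟧-homo-+ : ∀ a b → ⟦ a ℤ.+ b ⟧ ≡ ⟦ a ⟧ + ⟦ b ⟧
⟦⟧-homo-+ a b = begin
  ⟦ a ℤ.+ b ⟧                              ≡⟨ ℚP./-cong (+-unit a b) refl ⟩
  (a ℤ.* + 1 ℤ.+ b ℤ.* + 1) ℚ./ 1          ≡⟨⟩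
  ⟦ a ⟧′ + ⟦ b ⟧′                          ≡⟨ sym (cong₂ _+_ (⟦⟧≡⟦⟧′ a) (⟦⟧≡⟦⟧′ b)) ⟩
  ⟦ a ⟧ + ⟦ b ⟧                            ∎
  where
  open ≡-Reasoning
  +-unit : ∀ a b → a ℤ.+ b ≡ a ℤ.* + 1 ℤ.+ b ℤ.* + 1
  +-unit = ℤ-solve

⟦⟧-homo-* : ∀ a b → ⟦ a ℤ.* b ⟧ ≡ ⟦ a ⟧ * ⟦ b ⟧
⟦⟧-homo-* a b = sym (cong₂ _*_ (⟦⟧≡⟦⟧′ a) (⟦⟧≡⟦⟧′ b))

⟦⟧-homo-neg : ∀ a → ⟦ ℤ.- a ⟧ ≡ - ⟦ a ⟧
⟦⟧-homo-neg a = trans (⟦⟧≡⟦⟧′ (ℤ.- a)) (trans (neg a) (cong -_ (sym (⟦⟧≡⟦⟧′ a))))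
  where
  neg : ∀ a → ⟦ ℤ.- a ⟧′ ≡ - ⟦ a ⟧′
  neg (+ zero)  = refl
  neg (+ suc n) = refl
  neg -[1+ n ]  = refl

⟦⟧-homo-− : ∀ a b → ⟦ a ℤ.- b ⟧ ≡ ⟦ a ⟧ - ⟦ b ⟧
⟦⟧-homo-− a b = trans (⟦⟧-homo-+ a (ℤ.- b)) (cong (λ t → ⟦ a ⟧ + t) (⟦⟧-homo-neg b))

⟦⟧-mono-≤ : ∀ {a b} → a ℤ.≤ b → ⟦ a ⟧ ≤ ⟦ b ⟧
⟦⟧-mono-≤ {a} {b} a≤b rewrite ⟦⟧≡⟦⟧′ a | ⟦⟧≡⟦⟧′ b =
  ℚ.*≤* (subst₂ ℤ._≤_ (sym (ℤP.*-identityʳ a)) (sym (ℤP.*-identityʳ b)) a≤b)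

⟦⟧-mono-< : ∀ {a b} → a ℤ.< b → ⟦ a ⟧ < ⟦ b ⟧
⟦⟧-mono-< {a} {b} a<b rewrite ⟦⟧≡⟦⟧′ a | ⟦⟧≡⟦⟧′ b =
  ℚ.*<* (subst₂ ℤ._<_ (sym (ℤP.*-identityʳ a)) (sym (ℤP.*-identityʳ b)) a<b)

infixl 6 _+ᵖ_ _-ᵖ_
infixl 7 _·ᵖ_

_+ᵖ_ : Point → Point → Point
(a , b) +ᵖ (c , d) = (a ℤ.+ c , b ℤ.+ d)

_-ᵖ_ : Point → Point → Point
(a , b) -ᵖ (c , d) = (a ℤ.- c , b ℤ.- d)

_·ᵖ_ : ℤ → Point → Point
k ·ᵖ (a , b) = (k ℤ.* a , k ℤ.* b)

0ᵖ : Point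
0ᵖ = (0ℤ , 0ℤ)

det : Point → Point → ℤ
det (a , b) (c , d) = a ℤ.* d ℤ.- c ℤ.* b

area₂ : Point → Point → Point → ℤ
area₂ p q r = det (q -ᵖ p) (r -ᵖ p)

lin-+ : ∀ p q x y → lin (p +ᵖ q) x y ≡ lin p x y + lin q x y
lin-+ (a , b) (c , d) x y
  rewrite ⟦⟧-homo-+ a c | ⟦⟧-homo-+ b d = distrib ⟦ a ⟧ ⟦ b ⟧ ⟦ c ⟧ ⟦ d ⟧ x y
  where
  distrib : ∀ a b c d x y → (a + c) * x + (b + d) * y ≡ a * x + b * y + (c * x + d * y)
  distrib = solve-∀ ℚ-ring

lin-− : ∀ p q x y → lin (p -ᵖ q) x y ≡ lin p x y - lin q x y
lin-− (a , b) (c , d) x y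
  rewrite ⟦⟧-homo-− a c | ⟦⟧-homo-− b d = distrib ⟦ a ⟧ ⟦ b ⟧ ⟦ c ⟧ ⟦ d ⟧ x y
  where
  distrib : ∀ a b c d x y → (a - c) * x + (b - d) * y ≡ a * x + b * y - (c * x + d * y)
  distrib = solve-∀ ℚ-ring

lin-· : ∀ k p x y → lin (k ·ᵖ p) x y ≡ ⟦ k ⟧ * lin p x y
lin-· k (a , b) x y
  rewrite ⟦⟧-homo-* k a | ⟦⟧-homo-* k b = distrib ⟦ k ⟧ ⟦ a ⟧ ⟦ b ⟧ x y
  where
  distrib : ∀ k a b x y → k * a * x + k * b * y ≡ k * (a * x + b * y)
  distrib = solve-∀ ℚ-ring

lin-0 : ∀ x y → lin 0ᵖ x y ≡ 0ℚ
lin-0 = annihilate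
  where
  annihilate : ∀ x y → 0ℚ * x + 0ℚ * y ≡ 0ℚ
  annihilate = solve-∀ ℚ-ring

private
  scale-≤ : ∀ {α a b} → 0ℚ ≤ α → a ≤ b → α * a ≤ α * b
  scale-≤ {α} 0≤α = ℚP.*-monoˡ-≤-nonNeg α {{ℚ.nonNegative 0≤α}}

  cancel-≤ : ∀ {e a b} → 0ℚ < e → e * a ≤ e * b → a ≤ b
  cancel-≤ {e} 0<e = ℚP.*-cancelˡ-≤-pos e {{ℚ.positive 0<e}}

  p≤q⇒0≤q-p : ∀ {p q} → p ≤ q → 0ℚ ≤ q - p
  p≤q⇒0≤q-p {p} {q} p≤q = subst (_≤ q - p) (ℚP.+-inverseʳ p) (ℚP.+-monoˡ-≤ (- p) p≤q)

⊔-translate : ∀ k a b → k + (a ⊔ b) ≡ (k + a) ⊔ (k + b)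
⊔-translate k = ℚP.mono-≤-distrib-⊔ (ℚP.+-monoʳ-≤ k)

rearrange : ∀ {l r s t} → s ≡ t → l ≡ r + (t - s) → l ≡ r
rearrange {r = r} {s} refl eq = trans eq (trans (cong (λ e → r + e) (ℚP.+-inverseʳ s)) (ℚP.+-identityʳ r))

convex₃-≤-⊔ : ∀ {α β γ a b d c} → 0ℚ ≤ α → 0ℚ ≤ β → 0ℚ ≤ γ → 0ℚ < α + β + γ →
              (α + β + γ) * c ≡ α * a + β * b + γ * d → c ≤ a ⊔ (b ⊔ d)
convex₃-≤-⊔ {α} {β} {γ} {a} {b} {d} {c} 0≤α 0≤β 0≤γ 0<e eq = cancel-≤ 0<e (begin
  (α + β + γ) * c          ≡⟨ eq ⟩
  α * a + β * b + γ * d    ≤⟨ ℚP.+-mono-≤ (ℚP.+-mono-≤ (scale-≤ 0≤α a≤M) (scale-≤ 0≤β b≤M))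
                                          (scale-≤ 0≤γ d≤M) ⟩
  α * M + β * M + γ * M    ≡⟨ factor α β γ M ⟩
  (α + β + γ) * M          ∎)
  where
  open ℚP.≤-Reasoning
  M = a ⊔ (b ⊔ d)
  a≤M = ℚP.p≤p⊔q a (b ⊔ d)
  b≤M = ℚP.≤-trans (ℚP.p≤p⊔q b d) (ℚP.p≤q⊔p a (b ⊔ d))
  d≤M = ℚP.≤-trans (ℚP.p≤q⊔p b d) (ℚP.p≤q⊔p a (b ⊔ d))
  factor : ∀ α β γ M → α * M + β * M + γ * M ≡ (α + β + γ) * M
  factor = solve-∀ ℚ-ring

convex₃-⊓-≤ : ∀ {α β γ a b d c} → 0ℚ ≤ α → 0ℚ ≤ β → 0ℚ ≤ γ → 0ℚ < α + β + γ →
              (α + β + γ) * c ≡ α * a + β * b + γ * d → a ⊓ (b ⊓ d) ≤ c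
convex₃-⊓-≤ {α} {β} {γ} {a} {b} {d} {c} 0≤α 0≤β 0≤γ 0<e eq = cancel-≤ 0<e (begin
  (α + β + γ) * m          ≡⟨ factor α β γ m ⟨
  α * m + β * m + γ * m    ≤⟨ ℚP.+-mono-≤ (ℚP.+-mono-≤ (scale-≤ 0≤α m≤a) (scale-≤ 0≤β m≤b))
                                          (scale-≤ 0≤γ m≤d) ⟩
  α * a + β * b + γ * d    ≡⟨ eq ⟨
  (α + β + γ) * c          ∎)
  where
  open ℚP.≤-Reasoning
  m = a ⊓ (b ⊓ d)
  m≤a = ℚP.p⊓q≤p a (b ⊓ d)
  m≤b = ℚP.≤-trans (ℚP.p⊓q≤q a (b ⊓ d)) (ℚP.p⊓q≤p b d)
  m≤d = ℚP.≤-trans (ℚP.p⊓q≤q a (b ⊓ d)) (ℚP.p⊓q≤q b d)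
  factor : ∀ α β γ M → α * M + β * M + γ * M ≡ (α + β + γ) * M
  factor = solve-∀ ℚ-ring

balanced-⊓-≤-⊔ : ∀ {α β γ δ p q r s} → 0ℚ ≤ α → 0ℚ ≤ β → 0ℚ ≤ γ → 0ℚ ≤ δ →
                 0ℚ < α + β → α + β ≡ γ + δ → α * p + β * q ≡ γ * r + δ * s → p ⊓ q ≤ r ⊔ s
balanced-⊓-≤-⊔ {α} {β} {γ} {δ} {p} {q} {r} {s} 0≤α 0≤β 0≤γ 0≤δ 0<α+β sum eq =
  cancel-≤ 0<α+β (begin
    (α + β) * m            ≡⟨ factor α β m ⟩
    α * m + β * m          ≤⟨ ℚP.+-mono-≤ (scale-≤ 0≤α (ℚP.p⊓q≤p p q)) (scale-≤ 0≤β (ℚP.p⊓q≤q p q)) ⟩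
    α * p + β * q          ≡⟨ eq ⟩
    γ * r + δ * s          ≤⟨ ℚP.+-mono-≤ (scale-≤ 0≤γ (ℚP.p≤p⊔q r s)) (scale-≤ 0≤δ (ℚP.p≤q⊔p r s)) ⟩
    γ * M + δ * M          ≡⟨ sym (factor γ δ M) ⟩
    (γ + δ) * M            ≡⟨ cong (_* M) (sym sum) ⟩
    (α + β) * M            ∎)
  where
  open ℚP.≤-Reasoning
  m = p ⊓ q
  M = r ⊔ s
  factor : ∀ α β m → (α + β) * m ≡ α * m + β * m
  factor = solve-∀ ℚ-ring

convex₂-≤-⊔ : ∀ {α β a b c} → 0ℚ ≤ α → 0ℚ ≤ β → 0ℚ < α + β →
              (α + β) * c ≡ α * a + β * b → c ≤ a ⊔ b
convex₂-≤-⊔ {α} {β} {a} {b} {c} 0≤α 0≤β 0<α+β eq =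
  subst (_≤ a ⊔ b) (ℚP.⊓-idem c)
        (balanced-⊓-≤-⊔ 0≤α 0≤β 0≤α 0≤β 0<α+β refl (trans (sym (factor α β c)) eq))
  where
  factor : ∀ α β c → (α + β) * c ≡ α * c + β * c
  factor = solve-∀ ℚ-ring

⊔-split : ∀ {a b r} → a ⊓ b ≤ r → a ⊔ (b ⊔ r) ≡ (b ⊔ r) + (a ⊔ r) - r
⊔-split {a} {b} {r} a⊓b≤r with ℚP.⊓-sel a b
... | inj₁ a⊓b≡a
  rewrite ℚP.p≤q⇒p⊔q≡q (ℚP.≤-trans (subst (_≤ r) a⊓b≡a a⊓b≤r) (ℚP.p≤q⊔p b r))
        | ℚP.p≤q⇒p⊔q≡q (subst (_≤ r) a⊓b≡a a⊓b≤r) = cancel (b ⊔ r) r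
  where
  cancel : ∀ m r → m ≡ m + r - r
  cancel = solve-∀ ℚ-ring
... | inj₂ a⊓b≡b
  rewrite ℚP.p≤q⇒p⊔q≡q (subst (_≤ r) a⊓b≡b a⊓b≤r) = cancel (a ⊔ r) r
  where
  cancel : ∀ m r → m ≡ r + m - r
  cancel = solve-∀ ℚ-ring

private
  ⊓₃-≤-sel : ∀ {z a b c} → z ⊓ (a ⊓ b) ≤ c → z ≤ c ⊎ a ≤ c ⊎ b ≤ c
  ⊓₃-≤-sel {z} {a} {b} {c} min≤c with ℚP.⊓-sel z (a ⊓ b)
  ... | inj₁ min≡z = inj₁ (subst (_≤ c) min≡z min≤c)
  ... | inj₂ min≡a⊓b with ℚP.⊓-sel a b
  ...   | inj₁ a⊓b≡a = inj₂ (inj₁ (subst (_≤ c) (trans min≡a⊓b a⊓b≡a) min≤c))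
  ...   | inj₂ a⊓b≡b = inj₂ (inj₂ (subst (_≤ c) (trans min≡a⊓b a⊓b≡b) min≤c))

star-subdivision : ∀ {z a b c} → z ⊓ (a ⊓ b) ≤ c → c ≤ z ⊔ (a ⊔ b) →
  z ⊔ (a ⊔ b) ≡ (z ⊔ (a ⊔ c)) + (z ⊔ (c ⊔ b)) + (a ⊔ (b ⊔ c))
                - (z ⊔ c) - (a ⊔ c) - (b ⊔ c) + c
star-subdivision {z} {a} {b} {c} min≤c c≤max with ⊓₃-≤-sel {z} {a} {b} min≤c
... | inj₁ z≤c
  rewrite ℚP.p≤q⇒p⊔q≡q (ℚP.≤-trans z≤c (ℚP.p≤q⊔p a c))
        | ℚP.p≤q⇒p⊔q≡q (ℚP.≤-trans z≤c (ℚP.p≤p⊔q c b))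
        | ℚP.p≤q⇒p⊔q≡q z≤c | ℚP.⊔-comm c b =
  trans (ℚP.≤-antisym (ℚP.⊔-lub (ℚP.≤-trans z≤c (ℚP.≤-trans (ℚP.p≤q⊔p b c) (ℚP.p≤q⊔p a _)))
                          (ℚP.⊔-mono-≤ (ℚP.≤-refl {a}) (ℚP.p≤p⊔q b c)))
                   (ℚP.⊔-lub (ℚP.≤-trans (ℚP.p≤p⊔q a b) (ℚP.p≤q⊔p z _))
                          (ℚP.⊔-lub (ℚP.≤-trans (ℚP.p≤q⊔p a b) (ℚP.p≤q⊔p z _)) c≤max)))
        (cancel (a ⊔ c) (b ⊔ c) (a ⊔ (b ⊔ c)) c)
  where
  cancel : ∀ X Y M c → M ≡ X + Y + M - c - X - Y + c
  cancel = solve-∀ ℚ-ring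
... | inj₂ (inj₁ a≤c)
  rewrite ℚP.p≤q⇒p⊔q≡q a≤c | ℚP.p≤q⇒p⊔q≡q (ℚP.≤-trans a≤c (ℚP.p≤q⊔p b c)) =
  trans (ℚP.≤-antisym (ℚP.⊔-mono-≤ (ℚP.≤-refl {z}) (ℚP.⊔-mono-≤ a≤c (ℚP.≤-refl {b})))
                   (ℚP.⊔-lub (ℚP.p≤p⊔q z _) (ℚP.⊔-lub c≤max (ℚP.≤-trans (ℚP.p≤q⊔p a b) (ℚP.p≤q⊔p z _)))))
        (cancel (z ⊔ c) (b ⊔ c) (z ⊔ (c ⊔ b)) c)
  where
  cancel : ∀ X Y M c → M ≡ X + M + Y - X - c - Y + c
  cancel = solve-∀ ℚ-ring
... | inj₂ (inj₂ b≤c)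
  rewrite ℚP.p≥q⇒p⊔q≡p b≤c | ℚP.p≤q⇒p⊔q≡q b≤c =
  trans (ℚP.≤-antisym (ℚP.⊔-mono-≤ (ℚP.≤-refl {z}) (ℚP.⊔-mono-≤ (ℚP.≤-refl {a}) b≤c))
                   (ℚP.⊔-lub (ℚP.p≤p⊔q z _) (ℚP.⊔-lub (ℚP.≤-trans (ℚP.p≤p⊔q a b) (ℚP.p≤q⊔p z _)) c≤max)))
        (cancel (z ⊔ c) (a ⊔ c) (z ⊔ (a ⊔ c)) c)
  where
  cancel : ∀ X Y M c → M ≡ M + X + Y - X - Y - c + c
  cancel = solve-∀ ℚ-ring

private
  p≤p+q : ∀ {p q} → 0ℚ ≤ q → p ≤ p + q
  p≤p+q {p} 0≤q = subst (_≤ p + _) (ℚP.+-identityʳ p) (ℚP.+-monoʳ-≤ p 0≤q)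

  p+q≤p : ∀ {p q} → q ≤ 0ℚ → p + q ≤ p
  p+q≤p {p} q≤0 = subst (p + _ ≤_) (ℚP.+-identityʳ p) (ℚP.+-monoʳ-≤ p q≤0)

  q≤p+q : ∀ {p q} → 0ℚ ≤ p → q ≤ p + q
  q≤p+q {p} {q} 0≤p = subst (_≤ p + q) (ℚP.+-identityˡ q) (ℚP.+-monoˡ-≤ q 0≤p)

  p+q≤q : ∀ {p q} → p ≤ 0ℚ → p + q ≤ q
  p+q≤q {p} {q} p≤0 = subst (p + q ≤_) (ℚP.+-identityˡ q) (ℚP.+-monoˡ-≤ q p≤0)

0⊔-sum : ∀ a b →
  0ℚ ⊔ (a + b) ≡ (0ℚ ⊔ (a ⊔ (a + b))) + (0ℚ ⊔ (b ⊔ (a + b))) - (0ℚ ⊔ a) - (0ℚ ⊔ b)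
0⊔-sum a b with ℚP.≤-total a 0ℚ | ℚP.≤-total b 0ℚ
... | inj₁ a≤0 | inj₁ b≤0
  rewrite ℚP.p≥q⇒p⊔q≡p (p+q≤p {a} b≤0) | ℚP.p≥q⇒p⊔q≡p (p+q≤q {a} {b} a≤0)
        | ℚP.p≥q⇒p⊔q≡p a≤0 | ℚP.p≥q⇒p⊔q≡p b≤0
        | ℚP.p≥q⇒p⊔q≡p (ℚP.≤-trans (p+q≤p {a} b≤0) a≤0) = refl
... | inj₂ 0≤a | inj₂ 0≤b
  rewrite ℚP.p≤q⇒p⊔q≡q (p≤p+q {a} 0≤b) | ℚP.p≤q⇒p⊔q≡q (q≤p+q {a} {b} 0≤a)
        | ℚP.p≤q⇒p⊔q≡q 0≤a | ℚP.p≤q⇒p⊔q≡q 0≤b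
        | ℚP.p≤q⇒p⊔q≡q (ℚP.≤-trans 0≤a (p≤p+q {a} 0≤b)) = cancel a b
  where
  cancel : ∀ a b → a + b ≡ (a + b) + (a + b) - a - b
  cancel = solve-∀ ℚ-ring
... | inj₁ a≤0 | inj₂ 0≤b
  rewrite ℚP.p≤q⇒p⊔q≡q (p≤p+q {a} 0≤b) | ℚP.p≥q⇒p⊔q≡p (p+q≤q {a} {b} a≤0)
        | ℚP.p≥q⇒p⊔q≡p a≤0 | ℚP.p≤q⇒p⊔q≡q 0≤b = cancel (0ℚ ⊔ (a + b)) b
  where
  cancel : ∀ m b → m ≡ m + b - 0ℚ - b
  cancel = solve-∀ ℚ-ring
... | inj₂ 0≤a | inj₁ b≤0
  rewrite ℚP.p≥q⇒p⊔q≡p (p+q≤p {a} b≤0) | ℚP.p≤q⇒p⊔q≡q (q≤p+q {a} {b} 0≤a)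
        | ℚP.p≤q⇒p⊔q≡q 0≤a | ℚP.p≥q⇒p⊔q≡p b≤0 = cancel (0ℚ ⊔ (a + b)) a
  where
  cancel : ∀ m a → m ≡ a + m - a - 0ℚ
  cancel = solve-∀ ℚ-ring

-- Decomposable functions

Fn : Set
Fn = ℚ → ℚ → ℚ

infix 4 _≐_
infixl 6 _+ᶠ_ _-ᶠ_
infixl 7 _·ᶠ_

_≐_ : Fn → Fn → Set
F ≐ G = ∀ x y → F x y ≡ G x y

infixr 5 _⟨≐⟩_
_⟨≐⟩_ : ∀ {F G H} → F ≐ G → G ≐ H → F ≐ H
(F≐G ⟨≐⟩ G≐H) x y = trans (F≐G x y) (G≐H x y)

_+ᶠ_ _-ᶠ_ : Fn → Fn → Fn
(F +ᶠ G) x y = F x y + G x y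
(F -ᶠ G) x y = F x y - G x y

_·ᶠ_ : ℤ → Fn → Fn
(k ·ᶠ F) x y = ⟦ k ⟧ * F x y

expansion : Point → ℤ → ℤ → List (ℤ × Triangle) → Fn
expansion ab₀ kx ky S x y = lin ab₀ x y + ⟦ kx ⟧ * (0ℚ ⊔ x) + ⟦ ky ⟧ * (0ℚ ⊔ y) + triSum S x y

record Decomposable (F : Fn) : Set where
  constructor decomposition
  field
    ab₀ : Point
    kx ky : ℤ
    S : List (ℤ × Triangle)
    all-Tuni : All (λ kT → InTuni (proj₂ kT)) S
    expand : F ≐ expansion ab₀ kx ky S

triSum-++ : ∀ S S′ x y → triSum (S ++ S′) x y ≡ triSum S x y + triSum S′ x y
triSum-++ []            S′ x y = sym (ℚP.+-identityˡ _)
triSum-++ ((k , T) ∷ S) S′ x y rewrite triSum-++ S S′ x y =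
  sym (ℚP.+-assoc (⟦ k ⟧ * maxOf (vertices T) x y) (triSum S x y) (triSum S′ x y))

triSum-scale : ∀ k S x y → triSum (map (map₁ (k ℤ.*_)) S) x y ≡ ⟦ k ⟧ * triSum S x y
triSum-scale k []            x y = sym (ℚP.*-zeroʳ ⟦ k ⟧)
triSum-scale k ((c , T) ∷ S) x y rewrite triSum-scale k S x y | ⟦⟧-homo-* k c =
  distrib ⟦ k ⟧ ⟦ c ⟧ (maxOf (vertices T) x y) (triSum S x y)
  where
  distrib : ∀ k c m t → k * c * m + k * t ≡ k * (c * m + t)
  distrib = solve-∀ ℚ-ring

decomposable-≐ : ∀ {F G} → F ≐ G → Decomposable G → Decomposable F
decomposable-≐ F≐G (decomposition ab₀ kx ky S all-Tuni expand) =
  decomposition ab₀ kx ky S all-Tuni (F≐G ⟨≐⟩ expand)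

infixl 6 _+ᵈ_ _-ᵈ_
infixr 7 _·ᵈ_

_+ᵈ_ : ∀ {F G} → Decomposable F → Decomposable G → Decomposable (F +ᶠ G)
_+ᵈ_ {F} {G} (decomposition ab kx ky S all-S F≐) (decomposition ab′ kx′ ky′ S′ all-S′ G≐) =
  decomposition (ab +ᵖ ab′) (kx ℤ.+ kx′) (ky ℤ.+ ky′) (S ++ S′) (All.++⁺ all-S all-S′) expand
  where
  expand : F +ᶠ G ≐ expansion (ab +ᵖ ab′) (kx ℤ.+ kx′) (ky ℤ.+ ky′) (S ++ S′)
  expand x y rewrite F≐ x y | G≐ x y | lin-+ ab ab′ x y
                   | ⟦⟧-homo-+ kx kx′ | ⟦⟧-homo-+ ky ky′ | triSum-++ S S′ x y =
    regroup (lin ab x y) (lin ab′ x y) ⟦ kx ⟧ ⟦ kx′ ⟧ ⟦ ky ⟧ ⟦ ky′ ⟧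
            (0ℚ ⊔ x) (0ℚ ⊔ y) (triSum S x y) (triSum S′ x y)
    where
    regroup : ∀ l l′ a a′ b b′ X Y t t′ →
      (l + a * X + b * Y + t) + (l′ + a′ * X + b′ * Y + t′)
        ≡ (l + l′) + (a + a′) * X + (b + b′) * Y + (t + t′)
    regroup = solve-∀ ℚ-ring

_·ᵈ_ : ∀ {F} k → Decomposable F → Decomposable (k ·ᶠ F)
_·ᵈ_ {F} k (decomposition ab kx ky S all-S F≐) =
  decomposition (k ·ᵖ ab) (k ℤ.* kx) (k ℤ.* ky) (map (map₁ (k ℤ.*_)) S) (All.map⁺ all-S) expand
  where
  expand : k ·ᶠ F ≐ expansion (k ·ᵖ ab) (k ℤ.* kx) (k ℤ.* ky) (map (map₁ (k ℤ.*_)) S)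
  expand x y rewrite F≐ x y | lin-· k ab x y | ⟦⟧-homo-* k kx | ⟦⟧-homo-* k ky
                   | triSum-scale k S x y =
    distrib ⟦ k ⟧ (lin ab x y) ⟦ kx ⟧ ⟦ ky ⟧ (0ℚ ⊔ x) (0ℚ ⊔ y) (triSum S x y)
    where
    distrib : ∀ k l a b X Y t →
      k * (l + a * X + b * Y + t) ≡ k * l + k * a * X + k * b * Y + k * t
    distrib = solve-∀ ℚ-ring

_-ᵈ_ : ∀ {F G} → Decomposable F → Decomposable G → Decomposable (F -ᶠ G)
_-ᵈ_ {F} {G} dF dG =
  decomposable-≐ (λ x y → cong (λ t → F x y + t) (minus (G x y)))
                 (dF +ᵈ (ℤ.- 1ℤ) ·ᵈ dG)
  where
  minus : ∀ g → - g ≡ - 1ℚ * g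
  minus = solve-∀ ℚ-ring

decomposable-lin : ∀ p → Decomposable (lin p)
decomposable-lin p = decomposition p 0ℤ 0ℤ [] [] (λ x y → pad (lin p x y) (0ℚ ⊔ x) (0ℚ ⊔ y))
  where
  pad : ∀ l X Y → l ≡ l + 0ℚ * X + 0ℚ * Y + 0ℚ
  pad = solve-∀ ℚ-ring

decomposable-x⁺ : Decomposable (λ x y → 0ℚ ⊔ x)
decomposable-x⁺ = decomposition 0ᵖ 1ℤ 0ℤ [] [] (λ x y → pad x y (0ℚ ⊔ x) (0ℚ ⊔ y))
  where
  pad : ∀ x y X Y → X ≡ 0ℚ * x + 0ℚ * y + 1ℚ * X + 0ℚ * Y + 0ℚ
  pad = solve-∀ ℚ-ring

decomposable-y⁺ : Decomposable (λ x y → 0ℚ ⊔ y)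
decomposable-y⁺ = decomposition 0ᵖ 0ℤ 1ℤ [] [] (λ x y → pad x y (0ℚ ⊔ x) (0ℚ ⊔ y))
  where
  pad : ∀ x y X Y → Y ≡ 0ℚ * x + 0ℚ * y + 0ℚ * X + 1ℚ * Y + 0ℚ
  pad = solve-∀ ℚ-ring

decomposable-Tuni : ∀ {T} → InTuni T → Decomposable (maxOf (vertices T))
decomposable-Tuni {T} T∈Tuni =
  decomposition 0ᵖ 0ℤ 0ℤ ((1ℤ , T) ∷ []) (T∈Tuni ∷ [])
    (λ x y → pad x y (0ℚ ⊔ x) (0ℚ ⊔ y) (maxOf (vertices T) x y))
  where
  pad : ∀ x y X Y m → m ≡ 0ℚ * x + 0ℚ * y + 0ℚ * X + 0ℚ * Y + (1ℚ * m + 0ℚ)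
  pad = solve-∀ ℚ-ring

seg₀ : Point → Fn
seg₀ w x y = 0ℚ ⊔ lin w x y

maxOf-translate : ∀ m P → maxOf P ≐ lin m +ᶠ maxOf (map⁺ (_-ᵖ m) P)
maxOf-translate m (p ∷ L) x y = go p L
  where
  shift : ∀ p → lin p x y ≡ lin m x y + lin (p -ᵖ m) x y
  shift p rewrite lin-− p m x y = cancel (lin m x y) (lin p x y)
    where
    cancel : ∀ k a → a ≡ k + (a - k)
    cancel = solve-∀ ℚ-ring
  go : ∀ p L → maxOf (p ∷ L) x y ≡ lin m x y + maxOf (map⁺ (_-ᵖ m) (p ∷ L)) x y
  go p []      = shift p
  go p (q ∷ L) = trans (cong₂ _⊔_ (shift p) (go q L)) (sym (⊔-translate (lin m x y) _ _))

lin-self : ∀ p x y → lin (p -ᵖ p) x y ≡ 0ℚ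
lin-self p x y = trans (lin-− p p x y) (ℚP.+-inverseʳ (lin p x y))

maxOf-pair : ∀ p q → maxOf (p ∷ q ∷ []) ≐ lin p +ᶠ seg₀ (q -ᵖ p)
maxOf-pair p q x y =
  trans (maxOf-translate p (p ∷ q ∷ []) x y)
        (cong (λ t → lin p x y + (t ⊔ lin (q -ᵖ p) x y)) (lin-self p x y))

maxOf-head : ∀ p L x y → lin p x y ≤ maxOf (p ∷ L) x y
maxOf-head p []      x y = ℚP.≤-refl
maxOf-head p (q ∷ L) x y = ℚP.p≤p⊔q (lin p x y) (maxOf (q ∷ L) x y)

maxOf-drop : ∀ p Q → (∀ x y → lin p x y ≤ maxOf Q x y) → maxOf (p ∷⁺ Q) ≐ maxOf Q
maxOf-drop p Q redundant x y = ℚP.p≤q⇒p⊔q≡q (redundant x y)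

maxOf-split : ∀ p q Q → (∀ x y → lin p x y ⊓ lin q x y ≤ maxOf Q x y) →
              maxOf (p ∷⁺ q ∷⁺ Q) ≐ maxOf (q ∷⁺ Q) +ᶠ maxOf (p ∷⁺ Q) -ᶠ maxOf Q
maxOf-split p q Q crossing x y = ⊔-split {lin p x y} {lin q x y} (crossing x y)

maxOf-swap : ∀ p q L → maxOf (p ∷ q ∷ L) ≐ maxOf (q ∷ p ∷ L)
maxOf-swap p q []      x y = ℚP.⊔-comm (lin p x y) (lin q x y)
maxOf-swap p q (r ∷ L) x y = begin
  a ⊔ (b ⊔ m)   ≡⟨ ℚP.⊔-assoc a b m ⟨
  (a ⊔ b) ⊔ m   ≡⟨ cong (_⊔ m) (ℚP.⊔-comm a b) ⟩
  (b ⊔ a) ⊔ m   ≡⟨ ℚP.⊔-assoc b a m ⟩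
  b ⊔ (a ⊔ m)   ∎
  where
  open ≡-Reasoning
  a = lin p x y
  b = lin q x y
  m = maxOf (r ∷ L) x y

maxOf-swap₂ : ∀ p q r L → maxOf (p ∷ q ∷ r ∷ L) ≐ maxOf (p ∷ r ∷ q ∷ L)
maxOf-swap₂ p q r L x y = cong (lin p x y ⊔_) (maxOf-swap q r L x y)

maxOf-swap₃ : ∀ p q r s L → maxOf (p ∷ q ∷ r ∷ s ∷ L) ≐ maxOf (p ∷ q ∷ s ∷ r ∷ L)
maxOf-swap₃ p q r s L x y = cong (lin p x y ⊔_) (maxOf-swap₂ q r s L x y)

private
  +∣a-m∣ : ∀ {m a} → m ℤ.≤ a → + ∣ a ℤ.- m ∣ ≡ a ℤ.- m
  +∣a-m∣ m≤a = ℤP.0≤i⇒+∣i∣≡i (ℤP.i≤j⇒0≤j-i m≤a)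

  min₃-attained : ∀ a b c → let m = a ℤ.⊓ (b ℤ.⊓ c) in
    ∣ a ℤ.- m ∣ ≡ 0 ⊎ ∣ b ℤ.- m ∣ ≡ 0 ⊎ ∣ c ℤ.- m ∣ ≡ 0
  min₃-attained a b c with ℤP.⊓-sel a (b ℤ.⊓ c)
  ... | inj₁ m≡a rewrite m≡a = inj₁ (cong ∣_∣ (ℤP.+-inverseʳ a))
  ... | inj₂ m≡b⊓c rewrite m≡b⊓c with ℤP.⊓-sel b c
  ...   | inj₁ b⊓c≡b rewrite b⊓c≡b = inj₂ (inj₁ (cong ∣_∣ (ℤP.+-inverseʳ b)))
  ...   | inj₂ b⊓c≡c rewrite b⊓c≡c = inj₂ (inj₂ (cong ∣_∣ (ℤP.+-inverseʳ c)))

  min₃≤ : ∀ a b c → let m = a ℤ.⊓ (b ℤ.⊓ c) in m ℤ.≤ a × m ℤ.≤ b × m ℤ.≤ c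
  min₃≤ a b c = ℤP.i⊓j≤i a _
              , ℤP.≤-trans (ℤP.i⊓j≤j a _) (ℤP.i⊓j≤i b c)
              , ℤP.≤-trans (ℤP.i⊓j≤j a _) (ℤP.i⊓j≤j b c)

area₂-translate : ∀ p q r m → area₂ (p -ᵖ m) (q -ᵖ m) (r -ᵖ m) ≡ area₂ p q r
area₂-translate (p₁ , p₂) (q₁ , q₂) (r₁ , r₂) (m₁ , m₂) = cancel p₁ p₂ q₁ q₂ r₁ r₂ m₁ m₂
  where
  cancel : ∀ p₁ p₂ q₁ q₂ r₁ r₂ m₁ m₂ →
    ((q₁ ℤ.- m₁) ℤ.- (p₁ ℤ.- m₁)) ℤ.* ((r₂ ℤ.- m₂) ℤ.- (p₂ ℤ.- m₂))
      ℤ.- ((r₁ ℤ.- m₁) ℤ.- (p₁ ℤ.- m₁)) ℤ.* ((q₂ ℤ.- m₂) ℤ.- (p₂ ℤ.- m₂))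
    ≡ (q₁ ℤ.- p₁) ℤ.* (r₂ ℤ.- p₂) ℤ.- (r₁ ℤ.- p₁) ℤ.* (q₂ ℤ.- p₂)
  cancel = ℤ-solve

-- Translating by the coordinatewise minimum of the vertices moves the triangle into T_uni.
maxOf-unimodular : ∀ p q r → ∣ area₂ p q r ∣ ≡ 1 → Decomposable (maxOf (p ∷ q ∷ r ∷ []))
maxOf-unimodular p@(p₁ , p₂) q@(q₁ , q₂) r@(r₁ , r₂) unimodular =
  decomposable-≐ (λ x y → trans (maxOf-translate m (p ∷ q ∷ r ∷ []) x y)
                                (cong (λ P → lin m x y + maxOf P x y) (sym vertices-T)))
                 (decomposable-lin m +ᵈ decomposable-Tuni T∈Tuni)
  where
  m₁ = p₁ ℤ.⊓ (q₁ ℤ.⊓ r₁)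
  m₂ = p₂ ℤ.⊓ (q₂ ℤ.⊓ r₂)
  m = (m₁ , m₂)
  T = tri (∣ p₁ ℤ.- m₁ ∣) (∣ p₂ ℤ.- m₂ ∣)
          (∣ q₁ ℤ.- m₁ ∣) (∣ q₂ ℤ.- m₂ ∣)
          (∣ r₁ ℤ.- m₁ ∣) (∣ r₂ ℤ.- m₂ ∣)
  P′ = (+ a₁ T , + b₁ T)
  Q′ = (+ a₂ T , + b₂ T)
  R′ = (+ a₃ T , + b₃ T)
  shifted : P′ ≡ p -ᵖ m × Q′ ≡ q -ᵖ m × R′ ≡ r -ᵖ m
  shifted with min₃≤ p₁ q₁ r₁ | min₃≤ p₂ q₂ r₂
  ... | m≤p₁ , m≤q₁ , m≤r₁ | m≤p₂ , m≤q₂ , m≤r₂ =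
    cong₂ _,_ (+∣a-m∣ m≤p₁) (+∣a-m∣ m≤p₂) ,
    cong₂ _,_ (+∣a-m∣ m≤q₁) (+∣a-m∣ m≤q₂) ,
    cong₂ _,_ (+∣a-m∣ m≤r₁) (+∣a-m∣ m≤r₂)
  P′≡ = proj₁ shifted
  Q′≡ = proj₁ (proj₂ shifted)
  R′≡ = proj₂ (proj₂ shifted)
  vertices-T : vertices T ≡ map⁺ (_-ᵖ m) (p ∷ q ∷ r ∷ [])
  vertices-T = cong₂ _∷_ P′≡ (cong₂ _∷_ Q′≡ (cong₂ _∷_ R′≡ refl))
  det2-T : det2 T ≡ area₂ p q r
  det2-T = begin
    det2 T                                   ≡⟨⟩
    area₂ P′ Q′ R′
      ≡⟨ cong₂ (λ P QR → area₂ P (proj₁ QR) (proj₂ QR)) P′≡ (cong₂ _,_ Q′≡ R′≡) ⟩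
    area₂ (p -ᵖ m) (q -ᵖ m) (r -ᵖ m)         ≡⟨ area₂-translate p q r m ⟩
    area₂ p q r                              ∎
    where open ≡-Reasoning
  T∈Tuni : InTuni T
  T∈Tuni = trans (cong ∣_∣ det2-T) unimodular , min₃-attained p₁ q₁ r₁ , min₃-attained p₂ q₂ r₂

-- Segments

seg₀-cong : ∀ {v w} → v ≡ w → seg₀ v ≐ seg₀ w
seg₀-cong v≡w x y = cong (λ p → seg₀ p x y) v≡w

seg₀-scale : ∀ n w → seg₀ (+ n ·ᵖ w) ≐ + n ·ᶠ seg₀ w
seg₀-scale n w x y = begin
  0ℚ ⊔ lin (+ n ·ᵖ w) x y            ≡⟨ cong₂ _⊔_ (sym (ℚP.*-zeroʳ k)) (lin-· (+ n) w x y) ⟩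
  k * 0ℚ ⊔ k * lin w x y             ≡⟨ sym (ℚP.*-distribˡ-⊔-nonNeg k {{0≤k}} 0ℚ (lin w x y)) ⟩
  k * (0ℚ ⊔ lin w x y)               ∎
  where
  open ≡-Reasoning
  k = ⟦ + n ⟧
  0≤k = ℚ.nonNegative {k} (⟦⟧-mono-≤ {0ℤ} {+ n} (ℤ.+≤+ ℕ.z≤n))

seg₀-neg : ∀ w → seg₀ (0ᵖ -ᵖ w) ≐ seg₀ w -ᶠ lin w
seg₀-neg w x y = begin
  0ℚ ⊔ lin (0ᵖ -ᵖ w) x y            ≡⟨ cong (0ℚ ⊔_) (trans (lin-− 0ᵖ w x y) (cong (_- t) (lin-0 x y))) ⟩
  0ℚ ⊔ (0ℚ - t)                     ≡⟨ cong₂ _⊔_ (sym (ℚP.+-inverseʳ t)) (ℚP.+-identityˡ (- t)) ⟩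
  (t - t) ⊔ (- t)                   ≡⟨ ℚP.⊔-comm (t - t) (- t) ⟩
  (- t) ⊔ (t - t)                   ≡⟨ cong₂ _⊔_ (sym (ℚP.+-identityʳ (- t))) (ℚP.+-comm t (- t)) ⟩
  (- t + 0ℚ) ⊔ (- t + t)            ≡⟨ sym (⊔-translate (- t) 0ℚ t) ⟩
  - t + (0ℚ ⊔ t)                    ≡⟨ ℚP.+-comm (- t) (0ℚ ⊔ t) ⟩
  (0ℚ ⊔ t) - t                      ∎
  where
  open ≡-Reasoning
  t = lin w x y

-- The triangles 0, v, v + w and 0, w, v + w tile the parallelogram spanned by v and w.
seg₀-sum : ∀ v w → seg₀ (v +ᵖ w) ≐ maxOf (0ᵖ ∷ v ∷ v +ᵖ w ∷ []) +ᶠ maxOf (0ᵖ ∷ w ∷ v +ᵖ w ∷ [])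
                                   -ᶠ seg₀ v -ᶠ seg₀ w
seg₀-sum v w x y rewrite lin-0 x y | lin-+ v w x y = 0⊔-sum (lin v x y) (lin w x y)

private
  shrink-right : ∀ {a b c n} → b ℕ.< c → a ℕ.+ c ℕ.< suc n → a ℕ.+ b ℕ.< n
  shrink-right {a} b<c a+c<1+n = ℕP.<-≤-trans (ℕP.+-monoʳ-< a b<c) (ℕP.≤-pred a+c<1+n)

  shrink-left : ∀ {a b c n} → b ℕ.< c → c ℕ.+ a ℕ.< suc n → b ℕ.+ a ℕ.< n
  shrink-left {a} b<c c+a<1+n = ℕP.<-≤-trans (ℕP.+-monoˡ-< a b<c) (ℕP.≤-pred c+a<1+n)

  on-coordinates : ∀ {f g : ℤ → ℤ → ℤ} → (∀ a b → f a b ≡ g a b) →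
                   ∀ (v w : Point) → _≡_ {A = Point} (f (proj₁ v) (proj₁ w) , f (proj₂ v) (proj₂ w))
                                                     (g (proj₁ v) (proj₁ w) , g (proj₂ v) (proj₂ w))
  on-coordinates f≡g (a , b) (c , d) = cong₂ _,_ (f≡g a c) (f≡g b d)

  zero-left : ∀ k v w → 0ℤ ·ᵖ v +ᵖ k ·ᵖ w ≡ k ·ᵖ w
  zero-left k = on-coordinates (ring k)
    where
    ring : ∀ k a b → 0ℤ ℤ.* a ℤ.+ k ℤ.* b ≡ k ℤ.* b
    ring = ℤ-solve

  zero-right : ∀ m v w → m ·ᵖ v +ᵖ 0ℤ ·ᵖ w ≡ m ·ᵖ v
  zero-right m = on-coordinates (ring m)
    where
    ring : ∀ m a b → m ℤ.* a ℤ.+ 0ℤ ℤ.* b ≡ m ℤ.* a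
    ring = ℤ-solve

  ·ᵖ-distrib-+ᵖ : ∀ k v w → k ·ᵖ (v +ᵖ w) ≡ k ·ᵖ v +ᵖ k ·ᵖ w
  ·ᵖ-distrib-+ᵖ k = on-coordinates (ring k)
    where
    ring : ∀ k a b → k ℤ.* (a ℤ.+ b) ≡ k ℤ.* a ℤ.+ k ℤ.* b
    ring = ℤ-solve

  shift-left : ∀ m j v w → m ·ᵖ v +ᵖ (m ℤ.+ j) ·ᵖ w ≡ m ·ᵖ (v +ᵖ w) +ᵖ j ·ᵖ w
  shift-left m j = on-coordinates (ring m j)
    where
    ring : ∀ m j a b → m ℤ.* a ℤ.+ (m ℤ.+ j) ℤ.* b ≡ m ℤ.* (a ℤ.+ b) ℤ.+ j ℤ.* b
    ring = ℤ-solve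

  shift-right : ∀ j k v w → (j ℤ.+ k) ·ᵖ v +ᵖ k ·ᵖ w ≡ j ·ᵖ v +ᵖ k ·ᵖ (v +ᵖ w)
  shift-right j k = on-coordinates (ring j k)
    where
    ring : ∀ j k a b → (j ℤ.+ k) ℤ.* a ℤ.+ k ℤ.* b ≡ j ℤ.* a ℤ.+ k ℤ.* (a ℤ.+ b)
    ring = ℤ-solve

det-sum-left : ∀ v w → det (v +ᵖ w) w ≡ det v w
det-sum-left (a , b) (c , d) = expand a b c d
  where
  expand : ∀ a b c d → (a ℤ.+ c) ℤ.* d ℤ.- c ℤ.* (b ℤ.+ d) ≡ a ℤ.* d ℤ.- c ℤ.* b
  expand = ℤ-solve

det-sum-right : ∀ v w → det v (v +ᵖ w) ≡ det v w
det-sum-right (a , b) (c , d) = expand a b c d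
  where
  expand : ∀ a b c d → a ℤ.* (b ℤ.+ d) ℤ.- (a ℤ.+ c) ℤ.* b ≡ a ℤ.* d ℤ.- c ℤ.* b
  expand = ℤ-solve

segment-add : ∀ v w → ∣ det v w ∣ ≡ 1 → Decomposable (seg₀ v) → Decomposable (seg₀ w) →
              Decomposable (seg₀ (v +ᵖ w))
segment-add v@(a , b) w@(c , d) unimodular dv dw =
  decomposable-≐ (seg₀-sum v w)
    (maxOf-unimodular 0ᵖ v (v +ᵖ w) (trans (cong ∣_∣ (area-v a b c d)) unimodular)
     +ᵈ maxOf-unimodular 0ᵖ w (v +ᵖ w) (trans (trans (cong ∣_∣ (area-w a b c d)) (ℤP.∣-i∣≡∣i∣ (det v w))) unimodular)
     -ᵈ dv -ᵈ dw)
  where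
  area-v : ∀ a b c d →
    (a ℤ.- 0ℤ) ℤ.* (b ℤ.+ d ℤ.- 0ℤ) ℤ.- (a ℤ.+ c ℤ.- 0ℤ) ℤ.* (b ℤ.- 0ℤ) ≡ a ℤ.* d ℤ.- c ℤ.* b
  area-v = ℤ-solve
  area-w : ∀ a b c d →
    (c ℤ.- 0ℤ) ℤ.* (b ℤ.+ d ℤ.- 0ℤ) ℤ.- (a ℤ.+ c ℤ.- 0ℤ) ℤ.* (d ℤ.- 0ℤ) ≡ ℤ.- (a ℤ.* d ℤ.- c ℤ.* b)
  area-w = ℤ-solve

-- Subtractive Euclid (the Stern–Brocot tree): every frame it visits is unimodular.
segment-frame : ∀ n m k → m ℕ.+ k ℕ.< n → ∀ {v w} → ∣ det v w ∣ ≡ 1 →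
                Decomposable (seg₀ v) → Decomposable (seg₀ w) →
                Decomposable (seg₀ (+ m ·ᵖ v +ᵖ + k ·ᵖ w))
segment-frame (suc n) m k bound {v} {w} unimodular dv dw with ℕ.compare m k
... | ℕ.less zero j =
  decomposable-≐ (seg₀-cong (zero-left (+ k) v w) ⟨≐⟩ seg₀-scale k w) ((+ k) ·ᵈ dw)
... | ℕ.greater zero j =
  decomposable-≐ (seg₀-cong (zero-right (+ m) v w) ⟨≐⟩ seg₀-scale m v) ((+ m) ·ᵈ dv)
... | ℕ.equal m =
  decomposable-≐ (seg₀-cong (sym (·ᵖ-distrib-+ᵖ (+ m) v w)) ⟨≐⟩ seg₀-scale m (v +ᵖ w))
                 ((+ m) ·ᵈ segment-add v w unimodular dv dw)
... | ℕ.less (suc m) j =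
  decomposable-≐ (seg₀-cong (trans (cong (λ c → + suc m ·ᵖ v +ᵖ c ·ᵖ w) coefficient)
                                   (shift-left (+ suc m) (+ suc j) v w)))
    (segment-frame n (suc m) (suc j) (shrink-right {suc m} (ℕ.s≤s (ℕ.s≤s (ℕP.m≤n+m j m))) bound) {v +ᵖ w} {w}
                   (trans (cong ∣_∣ (det-sum-left v w)) unimodular) (segment-add v w unimodular dv dw) dw)
  where
  coefficient : + suc (suc m ℕ.+ j) ≡ + suc m ℤ.+ + suc j
  coefficient = trans (cong +_ (sym (ℕP.+-suc (suc m) j))) (ℤP.pos-+ (suc m) (suc j))
... | ℕ.greater (suc k) j =
  decomposable-≐ (seg₀-cong (trans (cong (λ c → c ·ᵖ v +ᵖ + suc k ·ᵖ w) coefficient)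
                                   (shift-right (+ suc j) (+ suc k) v w)))
    (segment-frame n (suc j) (suc k) (shrink-left {suc k} (ℕ.s≤s (ℕ.s≤s (ℕP.m≤n+m j k))) bound) {v} {v +ᵖ w}
                   (trans (cong ∣_∣ (det-sum-right v w)) unimodular) dv (segment-add v w unimodular dv dw))
  where
  coefficient : + suc (suc k ℕ.+ j) ≡ + suc j ℤ.+ + suc k
  coefficient = trans (cong (λ t → + suc t) (ℕP.+-comm (suc k) j)) (ℤP.pos-+ (suc j) (suc k))

e₁ e₂ : Point
e₁ = (1ℤ , 0ℤ)
e₂ = (0ℤ , 1ℤ)

private
  seg₀-e₁ : Decomposable (seg₀ e₁)
  seg₀-e₁ = decomposable-≐ (λ x y → cong (0ℚ ⊔_) (unit-x x y)) decomposable-x⁺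
    where
    unit-x : ∀ x y → 1ℚ * x + 0ℚ * y ≡ x
    unit-x = solve-∀ ℚ-ring

  seg₀-e₂ : Decomposable (seg₀ e₂)
  seg₀-e₂ = decomposable-≐ (λ x y → cong (0ℚ ⊔_) (unit-y x y)) decomposable-y⁺
    where
    unit-y : ∀ x y → 0ℚ * x + 1ℚ * y ≡ y
    unit-y = solve-∀ ℚ-ring

  segment-neg : ∀ w → Decomposable (seg₀ w) → Decomposable (seg₀ (0ᵖ -ᵖ w))
  segment-neg w dw = decomposable-≐ (seg₀-neg w) (dw -ᵈ decomposable-lin w)

  segment-upper : ∀ a b → Decomposable (seg₀ (a , + b))
  segment-upper (+ a) b =
    decomposable-≐ (seg₀-cong (sym (cong₂ _,_ (first (+ a) (+ b)) (second (+ a) (+ b)))))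
          (segment-frame _ a b ℕP.≤-refl refl seg₀-e₁ seg₀-e₂)
    where
    first : ∀ a b → a ℤ.* 1ℤ ℤ.+ b ℤ.* 0ℤ ≡ a
    first = ℤ-solve
    second : ∀ a b → a ℤ.* 0ℤ ℤ.+ b ℤ.* 1ℤ ≡ b
    second = ℤ-solve
  segment-upper -[1+ a ] b =
    decomposable-≐ (seg₀-cong (sym (cong₂ _,_ (first (+ b) (+ suc a)) (second (+ b) (+ suc a)))))
          (segment-frame _ b (suc a) ℕP.≤-refl refl seg₀-e₂ (segment-neg e₁ seg₀-e₁))
    where
    first : ∀ b a → b ℤ.* 0ℤ ℤ.+ a ℤ.* (0ℤ ℤ.- 1ℤ) ≡ ℤ.- a
    first = ℤ-solve
    second : ∀ b a → b ℤ.* 1ℤ ℤ.+ a ℤ.* (0ℤ ℤ.- 0ℤ) ≡ b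
    second = ℤ-solve

segment-decomposable : ∀ w → Decomposable (seg₀ w)
segment-decomposable (a , + b)       = segment-upper a b
segment-decomposable (a , -[1+ b ]) =
  decomposable-≐ (seg₀-cong (sym (cong₂ _,_ (double-neg a) (refl {x = -[1+ b ]}))))
        (segment-neg (ℤ.- a , + suc b) (segment-upper (ℤ.- a) (suc b)))
  where
  double-neg : ∀ a → 0ℤ ℤ.- ℤ.- a ≡ a
  double-neg = ℤ-solve

pair-decomposable : ∀ p q → Decomposable (maxOf (p ∷ q ∷ []))
pair-decomposable p q =
  decomposable-≐ (maxOf-pair p q) (decomposable-lin p +ᵈ segment-decomposable (q -ᵖ p))

dot : Point → Point → ℤ
dot (a , b) (c , d) = a ℤ.* c ℤ.+ b ℤ.* d

collinear-dot : ∀ u v → det u v ≡ 0ℤ → dot u u ·ᵖ v ≡ dot u v ·ᵖ u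
collinear-dot (a , b) (c , d) det≡0 = cong₂ _,_
  (trans (expand₁ a b c d) (trans (cong (λ t → t₁ ℤ.- b ℤ.* t) det≡0) (drop₁ t₁ b)))
  (trans (expand₂ a b c d) (trans (cong (λ t → t₂ ℤ.+ a ℤ.* t) det≡0) (drop₂ t₂ a)))
  where
  t₁ = (a ℤ.* c ℤ.+ b ℤ.* d) ℤ.* a
  t₂ = (a ℤ.* c ℤ.+ b ℤ.* d) ℤ.* b
  expand₁ : ∀ a b c d →
    (a ℤ.* a ℤ.+ b ℤ.* b) ℤ.* c ≡ (a ℤ.* c ℤ.+ b ℤ.* d) ℤ.* a ℤ.- b ℤ.* (a ℤ.* d ℤ.- c ℤ.* b)
  expand₁ = ℤ-solve
  expand₂ : ∀ a b c d →
    (a ℤ.* a ℤ.+ b ℤ.* b) ℤ.* d ≡ (a ℤ.* c ℤ.+ b ℤ.* d) ℤ.* b ℤ.+ a ℤ.* (a ℤ.* d ℤ.- c ℤ.* b)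
  expand₂ = ℤ-solve
  drop₁ : ∀ s b → s ℤ.- b ℤ.* 0ℤ ≡ s
  drop₁ = ℤ-solve
  drop₂ : ∀ s a → s ℤ.+ a ℤ.* 0ℤ ≡ s
  drop₂ = ℤ-solve

private
  square-nonneg : ∀ i → 0ℤ ℤ.≤ i ℤ.* i
  square-nonneg (+ zero)  = ℤ.+≤+ ℕ.z≤n
  square-nonneg +[1+ n ]  = ℤ.+≤+ ℕ.z≤n
  square-nonneg -[1+ n ]  = ℤ.+≤+ ℕ.z≤n

  dot-self-pos : ∀ u → 0ℤ ℤ.< dot u u ⊎ u ≡ 0ᵖ
  dot-self-pos (+ zero , + zero)   = inj₂ refl
  dot-self-pos (+ zero , +[1+ n ]) = inj₁ (ℤ.+<+ (ℕ.s≤s ℕ.z≤n))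
  dot-self-pos (+ zero , -[1+ n ]) = inj₁ (ℤ.+<+ (ℕ.s≤s ℕ.z≤n))
  dot-self-pos (+[1+ m ] , b)      = inj₁ (ℤP.+-mono-<-≤ (ℤ.+<+ (ℕ.s≤s ℕ.z≤n)) (square-nonneg b))
  dot-self-pos (-[1+ m ] , b)      = inj₁ (ℤP.+-mono-<-≤ (ℤ.+<+ (ℕ.s≤s ℕ.z≤n)) (square-nonneg b))

SomeRedundant : Fn → Fn → Fn → Set
SomeRedundant f g h = (∀ x y → f x y ≤ g x y ⊔ h x y)
                    ⊎ (∀ x y → g x y ≤ f x y ⊔ h x y)
                    ⊎ (∀ x y → h x y ≤ f x y ⊔ g x y)

-- h − f = (t/N)(g − f), so comparing t/N with 0 and 1 locates the middle one.
collinear-values : ∀ {N t} {f g h : Fn} → 0ℚ < N →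
                   (∀ x y → N * (h x y - f x y) ≡ t * (g x y - f x y)) → SomeRedundant f g h
collinear-values {N} {t} {f} {g} {h} 0<N rel with ℚP.≤-total t 0ℚ | ℚP.≤-total N t
... | inj₁ t≤0 | _ =
  inj₁ λ x y → convex₂-≤-⊔ (ℚP.neg-antimono-≤ t≤0) (ℚP.<⇒≤ 0<N)
                 (subst (_< - t + N) (ℚP.+-identityˡ 0ℚ) (ℚP.+-mono-≤-< (ℚP.neg-antimono-≤ t≤0) 0<N))
                 (rearrange (rel x y) (identity N t (f x y) (g x y) (h x y)))
  where
  identity : ∀ N t f g h → (- t + N) * f ≡ - t * g + N * h + (t * (g - f) - N * (h - f))
  identity = solve-∀ ℚ-ring
... | inj₂ 0≤t | inj₁ N≤t =
  inj₂ (inj₁ λ x y → convex₂-≤-⊔ (p≤q⇒0≤q-p N≤t) (ℚP.<⇒≤ 0<N)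
                       (subst (0ℚ <_) (sym (cancel t N)) (ℚP.<-≤-trans 0<N N≤t))
                       (rearrange (rel x y) (identity N t (f x y) (g x y) (h x y))))
  where
  cancel : ∀ t N → t - N + N ≡ t
  cancel = solve-∀ ℚ-ring
  identity : ∀ N t f g h → (t - N + N) * g ≡ (t - N) * f + N * h + (t * (g - f) - N * (h - f))
  identity = solve-∀ ℚ-ring
... | inj₂ 0≤t | inj₂ t≤N =
  inj₂ (inj₂ λ x y → convex₂-≤-⊔ (p≤q⇒0≤q-p t≤N) 0≤t
                       (subst (0ℚ <_) (sym (cancel N t)) 0<N)
                       (rearrange (sym (rel x y)) (identity N t (f x y) (g x y) (h x y))))
  where
  cancel : ∀ N t → N - t + t ≡ N
  cancel = solve-∀ ℚ-ring
  identity : ∀ N t f g h → (N - t + t) * h ≡ (N - t) * f + t * g + (N * (h - f) - t * (g - f))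
  identity = solve-∀ ℚ-ring

collinear-redundant : ∀ p q r → area₂ p q r ≡ 0ℤ → SomeRedundant (lin p) (lin q) (lin r)
collinear-redundant p q r collinear with dot-self-pos (q -ᵖ p)
... | inj₁ 0<N = collinear-values {⟦ dot u u ⟧} {⟦ dot u v ⟧} (⟦⟧-mono-< 0<N) relation
  where
  u = q -ᵖ p
  v = r -ᵖ p
  relation : ∀ x y → ⟦ dot u u ⟧ * (lin r x y - lin p x y) ≡ ⟦ dot u v ⟧ * (lin q x y - lin p x y)
  relation x y = begin
    ⟦ dot u u ⟧ * (lin r x y - lin p x y)    ≡⟨ cong (⟦ dot u u ⟧ *_) (lin-− r p x y) ⟨
    ⟦ dot u u ⟧ * lin v x y                  ≡⟨ lin-· (dot u u) v x y ⟨
    lin (dot u u ·ᵖ v) x y                   ≡⟨ cong (λ w → lin w x y) (collinear-dot u v collinear) ⟩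
    lin (dot u v ·ᵖ u) x y                   ≡⟨ lin-· (dot u v) u x y ⟩
    ⟦ dot u v ⟧ * lin u x y                  ≡⟨ cong (⟦ dot u v ⟧ *_) (lin-− q p x y) ⟩
    ⟦ dot u v ⟧ * (lin q x y - lin p x y)    ∎
    where open ≡-Reasoning
... | inj₂ q-p≡0 = inj₂ (inj₁ λ x y → subst (_≤ lin p x y ⊔ lin r x y) (sym (same x y)) (ℚP.p≤p⊔q _ _))
  where
  same : ∀ x y → lin q x y ≡ lin p x y
  same x y = begin
    lin q x y                          ≡⟨ split (lin q x y) (lin p x y) ⟩
    (lin q x y - lin p x y) + lin p x y ≡⟨ cong (_+ lin p x y) (lin-− q p x y) ⟨
    lin (q -ᵖ p) x y + lin p x y       ≡⟨ cong (λ w → lin w x y + lin p x y) q-p≡0 ⟩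
    lin 0ᵖ x y + lin p x y             ≡⟨ cong (_+ lin p x y) (lin-0 x y) ⟩
    0ℚ + lin p x y                     ≡⟨ ℚP.+-identityˡ (lin p x y) ⟩
    lin p x y                          ∎
    where
    open ≡-Reasoning
    split : ∀ a b → a ≡ (a - b) + b
    split = solve-∀ ℚ-ring

triangle-collinear : ∀ p q r → area₂ p q r ≡ 0ℤ → Decomposable (maxOf (p ∷ q ∷ r ∷ []))
triangle-collinear p q r collinear with collinear-redundant p q r collinear
... | inj₁ p-redundant =
  decomposable-≐ (maxOf-drop p (q ∷ r ∷ []) p-redundant) (pair-decomposable q r)
... | inj₂ (inj₁ q-redundant) =
  decomposable-≐ (maxOf-swap p q (r ∷ []) ⟨≐⟩ maxOf-drop q (p ∷ r ∷ []) q-redundant)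
                 (pair-decomposable p r)
... | inj₂ (inj₂ r-redundant) =
  decomposable-≐ (maxOf-swap₂ p q r [] ⟨≐⟩ maxOf-swap p r (q ∷ []) ⟨≐⟩ maxOf-drop r (p ∷ q ∷ []) r-redundant)
                 (pair-decomposable p q)

area₂-barycentric : ∀ p q r w →
  area₂ p q r ·ᵖ w ≡ area₂ w q r ·ᵖ p +ᵖ area₂ p w r ·ᵖ q +ᵖ area₂ p q w ·ᵖ r
area₂-barycentric (a , b) (c , d) (e , f) (g , h) = cong₂ _,_ (expand₁ a b c d e f g h) (expand₂ a b c d e f g h)
  where
  expand₁ : ∀ a b c d e f g h →
    ((c ℤ.- a) ℤ.* (f ℤ.- b) ℤ.- (e ℤ.- a) ℤ.* (d ℤ.- b)) ℤ.* g
    ≡ ((c ℤ.- g) ℤ.* (f ℤ.- h) ℤ.- (e ℤ.- g) ℤ.* (d ℤ.- h)) ℤ.* a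
      ℤ.+ ((g ℤ.- a) ℤ.* (f ℤ.- b) ℤ.- (e ℤ.- a) ℤ.* (h ℤ.- b)) ℤ.* c
      ℤ.+ ((c ℤ.- a) ℤ.* (h ℤ.- b) ℤ.- (g ℤ.- a) ℤ.* (d ℤ.- b)) ℤ.* e
  expand₁ = ℤ-solve
  expand₂ : ∀ a b c d e f g h →
    ((c ℤ.- a) ℤ.* (f ℤ.- b) ℤ.- (e ℤ.- a) ℤ.* (d ℤ.- b)) ℤ.* h
    ≡ ((c ℤ.- g) ℤ.* (f ℤ.- h) ℤ.- (e ℤ.- g) ℤ.* (d ℤ.- h)) ℤ.* b
      ℤ.+ ((g ℤ.- a) ℤ.* (f ℤ.- b) ℤ.- (e ℤ.- a) ℤ.* (h ℤ.- b)) ℤ.* d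
      ℤ.+ ((c ℤ.- a) ℤ.* (h ℤ.- b) ℤ.- (g ℤ.- a) ℤ.* (d ℤ.- b)) ℤ.* f
  expand₂ = ℤ-solve

area₂-sum : ∀ p q r w → area₂ p q r ≡ area₂ w q r ℤ.+ area₂ p w r ℤ.+ area₂ p q w
area₂-sum (a , b) (c , d) (e , f) (g , h) = expand a b c d e f g h
  where
  expand : ∀ a b c d e f g h →
    (c ℤ.- a) ℤ.* (f ℤ.- b) ℤ.- (e ℤ.- a) ℤ.* (d ℤ.- b)
    ≡ (c ℤ.- g) ℤ.* (f ℤ.- h) ℤ.- (e ℤ.- g) ℤ.* (d ℤ.- h)
      ℤ.+ ((g ℤ.- a) ℤ.* (f ℤ.- b) ℤ.- (e ℤ.- a) ℤ.* (h ℤ.- b))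
      ℤ.+ ((c ℤ.- a) ℤ.* (h ℤ.- b) ℤ.- (g ℤ.- a) ℤ.* (d ℤ.- b))
  expand = ℤ-solve

area₂-rotate : ∀ p q r → area₂ p q r ≡ area₂ q r p
area₂-rotate (a , b) (c , d) (e , f) = expand a b c d e f
  where
  expand : ∀ a b c d e f →
    (c ℤ.- a) ℤ.* (f ℤ.- b) ℤ.- (e ℤ.- a) ℤ.* (d ℤ.- b)
    ≡ (e ℤ.- c) ℤ.* (b ℤ.- d) ℤ.- (a ℤ.- c) ℤ.* (f ℤ.- d)
  expand = ℤ-solve

area₂-swap : ∀ p q r → area₂ p r q ≡ ℤ.- area₂ p q r
area₂-swap (a , b) (c , d) (e , f) = expand a b c d e f
  where
  expand : ∀ a b c d e f →
    (e ℤ.- a) ℤ.* (d ℤ.- b) ℤ.- (c ℤ.- a) ℤ.* (f ℤ.- b)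
    ≡ ℤ.- ((c ℤ.- a) ℤ.* (f ℤ.- b) ℤ.- (e ℤ.- a) ℤ.* (d ℤ.- b))
  expand = ℤ-solve

barycentric-lin : ∀ p q r w x y →
  ⟦ area₂ p q r ⟧ * lin w x y
    ≡ ⟦ area₂ w q r ⟧ * lin p x y + ⟦ area₂ p w r ⟧ * lin q x y + ⟦ area₂ p q w ⟧ * lin r x y
barycentric-lin p q r w x y = begin
  ⟦ area₂ p q r ⟧ * lin w x y                            ≡⟨ lin-· (area₂ p q r) w x y ⟨
  lin (area₂ p q r ·ᵖ w) x y                             ≡⟨ cong (λ v → lin v x y) (area₂-barycentric p q r w) ⟩
  lin (A₁ ·ᵖ p +ᵖ A₂ ·ᵖ q +ᵖ A₃ ·ᵖ r) x y               ≡⟨ lin-+ (A₁ ·ᵖ p +ᵖ A₂ ·ᵖ q) (A₃ ·ᵖ r) x y ⟩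
  lin (A₁ ·ᵖ p +ᵖ A₂ ·ᵖ q) x y + lin (A₃ ·ᵖ r) x y       ≡⟨ cong (_+ lin (A₃ ·ᵖ r) x y) (lin-+ (A₁ ·ᵖ p) (A₂ ·ᵖ q) x y) ⟩
  lin (A₁ ·ᵖ p) x y + lin (A₂ ·ᵖ q) x y + lin (A₃ ·ᵖ r) x y
      ≡⟨ cong₂ _+_ (cong₂ _+_ (lin-· A₁ p x y) (lin-· A₂ q x y)) (lin-· A₃ r x y) ⟩
  ⟦ A₁ ⟧ * lin p x y + ⟦ A₂ ⟧ * lin q x y + ⟦ A₃ ⟧ * lin r x y ∎
  where
  open ≡-Reasoning
  A₁ = area₂ w q r
  A₂ = area₂ p w r
  A₃ = area₂ p q w

barycentric-total : ∀ p q r w → ⟦ area₂ p q r ⟧ ≡ ⟦ area₂ w q r ⟧ + ⟦ area₂ p w r ⟧ + ⟦ area₂ p q w ⟧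
barycentric-total p q r w = begin
  ⟦ area₂ p q r ⟧                                      ≡⟨ cong ⟦_⟧ (area₂-sum p q r w) ⟩
  ⟦ area₂ w q r ℤ.+ area₂ p w r ℤ.+ area₂ p q w ⟧      ≡⟨ ⟦⟧-homo-+ (area₂ w q r ℤ.+ area₂ p w r) (area₂ p q w) ⟩
  ⟦ area₂ w q r ℤ.+ area₂ p w r ⟧ + ⟦ area₂ p q w ⟧    ≡⟨ cong (_+ ⟦ area₂ p q w ⟧) (⟦⟧-homo-+ (area₂ w q r) (area₂ p w r)) ⟩
  ⟦ area₂ w q r ⟧ + ⟦ area₂ p w r ⟧ + ⟦ area₂ p q w ⟧  ∎
  where open ≡-Reasoning

barycentric-values : ∀ p q r w x y →
  (⟦ area₂ w q r ⟧ + ⟦ area₂ p w r ⟧ + ⟦ area₂ p q w ⟧) * lin w x y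
    ≡ ⟦ area₂ w q r ⟧ * lin p x y + ⟦ area₂ p w r ⟧ * lin q x y + ⟦ area₂ p q w ⟧ * lin r x y
barycentric-values p q r w x y =
  trans (cong (_* lin w x y) (sym (barycentric-total p q r w))) (barycentric-lin p q r w x y)

-- Lattice points inside triangles

record InteriorPoint (p q r : Point) (n : ℕ) : Set where
  field
    point : Point
    α β γ : ℕ
    α-area : area₂ point q r ≡ + α
    β-area : area₂ p point r ≡ + β
    γ-area : area₂ p q point ≡ + γ
    α<n : α ℕ.< n
    β<n : β ℕ.< n
    γ<n : γ ℕ.< n

private
  +-minus : ∀ {a b} → b ℕ.≤ a → + a ℤ.- + b ≡ + (a ∸ b)
  +-minus {a} {b} b≤a = trans (ℤP.m-n≡m⊖n a b) (ℤP.⊖-≥ b≤a)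

  area₂-shift : ∀ p q r w →
    area₂ (p +ᵖ w) q r ≡ area₂ p q r ℤ.- det w (r -ᵖ p) ℤ.- det (q -ᵖ p) w
    × area₂ p (p +ᵖ w) r ≡ det w (r -ᵖ p)
    × area₂ p q (p +ᵖ w) ≡ det (q -ᵖ p) w
  area₂-shift (a , b) (c , d) (e , f) (g , h) =
    expand₁ a b c d e f g h , expand₂ a b e f g h , expand₃ a b c d g h
    where
    expand₁ : ∀ a b c d e f g h →
      (c ℤ.- (a ℤ.+ g)) ℤ.* (f ℤ.- (b ℤ.+ h)) ℤ.- (e ℤ.- (a ℤ.+ g)) ℤ.* (d ℤ.- (b ℤ.+ h))
      ≡ (c ℤ.- a) ℤ.* (f ℤ.- b) ℤ.- (e ℤ.- a) ℤ.* (d ℤ.- b)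
        ℤ.- (g ℤ.* (f ℤ.- b) ℤ.- (e ℤ.- a) ℤ.* h) ℤ.- ((c ℤ.- a) ℤ.* h ℤ.- g ℤ.* (d ℤ.- b))
    expand₁ = ℤ-solve
    expand₂ : ∀ a b e f g h →
      (a ℤ.+ g ℤ.- a) ℤ.* (f ℤ.- b) ℤ.- (e ℤ.- a) ℤ.* (b ℤ.+ h ℤ.- b)
      ≡ g ℤ.* (f ℤ.- b) ℤ.- (e ℤ.- a) ℤ.* h
    expand₂ = ℤ-solve
    expand₃ : ∀ a b c d g h →
      (c ℤ.- a) ℤ.* (b ℤ.+ h ℤ.- b) ℤ.- (a ℤ.+ g ℤ.- a) ℤ.* (d ℤ.- b)
      ≡ (c ℤ.- a) ℤ.* h ℤ.- g ℤ.* (d ℤ.- b)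
    expand₃ = ℤ-solve

  reflect-det : ∀ u v w → det (u +ᵖ v -ᵖ w) v ≡ det u v ℤ.- det w v × det u (u +ᵖ v -ᵖ w) ≡ det u v ℤ.- det u w
  reflect-det (a , b) (c , d) (e , f) = expand₁ a b c d e f , expand₂ a b c d e f
    where
    expand₁ : ∀ a b c d e f →
      (a ℤ.+ c ℤ.- e) ℤ.* d ℤ.- c ℤ.* (b ℤ.+ d ℤ.- f) ≡ a ℤ.* d ℤ.- c ℤ.* b ℤ.- (e ℤ.* d ℤ.- c ℤ.* f)
    expand₁ = ℤ-solve
    expand₂ : ∀ a b c d e f →
      a ℤ.* (b ℤ.+ d ℤ.- f) ℤ.- (a ℤ.+ c ℤ.- e) ℤ.* b ≡ a ℤ.* d ℤ.- c ℤ.* b ℤ.- (a ℤ.* f ℤ.- e ℤ.* b)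
    expand₂ = ℤ-solve

  positive-summand : ∀ {a b n} → n ℕ.< a ℕ.+ b → b ℕ.< n → 0 ℕ.< a
  positive-summand {zero}  n<b b<n = ⊥-elim (ℕP.<-asym n<b b<n)
  positive-summand {suc a} _   _   = ℕ.s≤s ℕ.z≤n

  -- p + w is a lattice point of the half-open parallelogram spanned by q − p and r − p at p;
  -- either it or its reflection in the midpoint of q r lies in the triangle.
  module Parallelogram (p q r : Point) {n} (area≡ : area₂ p q r ≡ + n) (w : Point) {r₁ r₂}
    (det₁ : det w (r -ᵖ p) ≡ + r₁) (det₂ : det (q -ᵖ p) w ≡ + r₂) (r₁<n : r₁ ℕ.< n) (r₂<n : r₂ ℕ.< n)
    where
    open ≡-Reasoning
    u = q -ᵖ p
    v = r -ᵖ p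

    lower-half : 0 ℕ.< r₁ ℕ.+ r₂ → r₁ ℕ.+ r₂ ℕ.≤ n → InteriorPoint p q r n
    lower-half 0<s s≤n = record
      { point = p +ᵖ w ; α = n ∸ (r₁ ℕ.+ r₂) ; β = r₁ ; γ = r₂
      ; α-area = begin
          area₂ (p +ᵖ w) q r                     ≡⟨ proj₁ shift ⟩
          area₂ p q r ℤ.- det w v ℤ.- det u w     ≡⟨ cong₂ (λ a b → a ℤ.- b ℤ.- _) area≡ det₁ ⟩
          + n ℤ.- + r₁ ℤ.- det u w               ≡⟨ cong (λ c → + n ℤ.- + r₁ ℤ.- c) det₂ ⟩
          + n ℤ.- + r₁ ℤ.- + r₂                  ≡⟨ regroup (+ n) (+ r₁) (+ r₂) ⟩
          + n ℤ.- (+ r₁ ℤ.+ + r₂)                ≡⟨ cong (λ s → + n ℤ.- s) (ℤP.pos-+ r₁ r₂) ⟨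
          + n ℤ.- + (r₁ ℕ.+ r₂)                  ≡⟨ +-minus s≤n ⟩
          + (n ∸ (r₁ ℕ.+ r₂))                    ∎
      ; β-area = trans (proj₁ (proj₂ shift)) det₁
      ; γ-area = trans (proj₂ (proj₂ shift)) det₂
      ; α<n = ℕP.∸-monoʳ-< 0<s s≤n ; β<n = r₁<n ; γ<n = r₂<n
      }
      where
      shift = area₂-shift p q r w
      regroup : ∀ n a b → n ℤ.- a ℤ.- b ≡ n ℤ.- (a ℤ.+ b)
      regroup = ℤ-solve

    upper-half : n ℕ.< r₁ ℕ.+ r₂ → InteriorPoint p q r n
    upper-half n<s = record
      { point = p +ᵖ w′ ; α = (r₁ ℕ.+ r₂) ∸ n ; β = n ∸ r₁ ; γ = n ∸ r₂
      ; α-area = begin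
          area₂ (p +ᵖ w′) q r                            ≡⟨ proj₁ shift ⟩
          area₂ p q r ℤ.- det w′ v ℤ.- det u w′           ≡⟨ cong₂ (λ a b → a ℤ.- b ℤ.- det u w′) area≡ β′ ⟩
          + n ℤ.- (+ n ℤ.- + r₁) ℤ.- det u w′             ≡⟨ cong (λ c → + n ℤ.- (+ n ℤ.- + r₁) ℤ.- c) γ′ ⟩
          + n ℤ.- (+ n ℤ.- + r₁) ℤ.- (+ n ℤ.- + r₂)       ≡⟨ regroup (+ n) (+ r₁) (+ r₂) ⟩
          (+ r₁ ℤ.+ + r₂) ℤ.- + n                         ≡⟨ cong (ℤ._- + n) (ℤP.pos-+ r₁ r₂) ⟨
          + (r₁ ℕ.+ r₂) ℤ.- + n                           ≡⟨ +-minus (ℕP.<⇒≤ n<s) ⟩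
          + ((r₁ ℕ.+ r₂) ∸ n)                             ∎
      ; β-area = trans (proj₁ (proj₂ shift)) (trans β′ (+-minus (ℕP.<⇒≤ r₁<n)))
      ; γ-area = trans (proj₂ (proj₂ shift)) (trans γ′ (+-minus (ℕP.<⇒≤ r₂<n)))
      ; α<n = subst ((r₁ ℕ.+ r₂) ∸ n ℕ.<_) (ℕP.m+n∸n≡m n n)
                    (ℕP.∸-monoˡ-< (ℕP.+-mono-< r₁<n r₂<n) (ℕP.<⇒≤ n<s))
      ; β<n = ℕP.∸-monoʳ-< (positive-summand n<s r₂<n) (ℕP.<⇒≤ r₁<n)
      ; γ<n = ℕP.∸-monoʳ-< (positive-summand {r₂} (subst (n ℕ.<_) (ℕP.+-comm r₁ r₂) n<s) r₁<n)
                           (ℕP.<⇒≤ r₂<n)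
      }
      where
      w′ = u +ᵖ v -ᵖ w
      shift = area₂-shift p q r w′
      β′ : det w′ v ≡ + n ℤ.- + r₁
      β′ = trans (proj₁ (reflect-det u v w)) (cong₂ ℤ._-_ area≡ det₁)
      γ′ : det u w′ ≡ + n ℤ.- + r₂
      γ′ = trans (proj₂ (reflect-det u v w)) (cong₂ ℤ._-_ area≡ det₂)
      regroup : ∀ n a b → n ℤ.- (n ℤ.- a) ℤ.- (n ℤ.- b) ≡ (a ℤ.+ b) ℤ.- n
      regroup = ℤ-solve

  module Residues (p q r : Point) (k : ℕ) (area≡ : area₂ p q r ≡ + suc (suc k)) where
    n = suc (suc k)
    u = q -ᵖ p
    v = r -ᵖ p

    remainder : ∀ X → X ℤ.- (X /ℕ n) ℤ.* + n ≡ + (X %ℕ n)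
    remainder X = begin
      X ℤ.- (X /ℕ n) ℤ.* + n                                   ≡⟨ cong (λ Y → Y ℤ.- (X /ℕ n) ℤ.* + n) (ℤDM.a≡a%ℕn+[a/ℕn]*n X n) ⟩
      + (X %ℕ n) ℤ.+ (X /ℕ n) ℤ.* + n ℤ.- (X /ℕ n) ℤ.* + n     ≡⟨ cancel (+ (X %ℕ n)) ((X /ℕ n) ℤ.* + n) ⟩
      + (X %ℕ n)                                               ∎
      where
      open ≡-Reasoning
      cancel : ∀ a b → a ℤ.+ b ℤ.- b ≡ a
      cancel = ℤ-solve

    reduce : Point → Point
    reduce z = z -ᵖ (det z v /ℕ n) ·ᵖ u -ᵖ (det u z /ℕ n) ·ᵖ v

    reduce-dets : ∀ z → det (reduce z) v ≡ + (det z v %ℕ n) × det u (reduce z) ≡ + (det u z %ℕ n)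
    reduce-dets z@(z₁ , z₂) =
      trans (expand₁ u v z₁ z₂ a b) (trans (cong (λ D → det z v ℤ.- a ℤ.* D) area≡) (remainder (det z v))) ,
      trans (expand₂ u v z₁ z₂ a b) (trans (cong (λ D → det u z ℤ.- b ℤ.* D) area≡) (remainder (det u z)))
      where
      a = det z v /ℕ n
      b = det u z /ℕ n
      expand₁ : ∀ u v z₁ z₂ a b → det ((z₁ , z₂) -ᵖ a ·ᵖ u -ᵖ b ·ᵖ v) v ≡ det (z₁ , z₂) v ℤ.- a ℤ.* det u v
      expand₁ (u₁ , u₂) (v₁ , v₂) z₁ z₂ a b = ring u₁ u₂ v₁ v₂ z₁ z₂ a b
        where
        ring : ∀ u₁ u₂ v₁ v₂ z₁ z₂ a b →
          (z₁ ℤ.- a ℤ.* u₁ ℤ.- b ℤ.* v₁) ℤ.* v₂ ℤ.- v₁ ℤ.* (z₂ ℤ.- a ℤ.* u₂ ℤ.- b ℤ.* v₂)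
          ≡ z₁ ℤ.* v₂ ℤ.- v₁ ℤ.* z₂ ℤ.- a ℤ.* (u₁ ℤ.* v₂ ℤ.- v₁ ℤ.* u₂)
        ring = ℤ-solve
      expand₂ : ∀ u v z₁ z₂ a b → det u ((z₁ , z₂) -ᵖ a ·ᵖ u -ᵖ b ·ᵖ v) ≡ det u (z₁ , z₂) ℤ.- b ℤ.* det u v
      expand₂ (u₁ , u₂) (v₁ , v₂) z₁ z₂ a b = ring u₁ u₂ v₁ v₂ z₁ z₂ a b
        where
        ring : ∀ u₁ u₂ v₁ v₂ z₁ z₂ a b →
          u₁ ℤ.* (z₂ ℤ.- a ℤ.* u₂ ℤ.- b ℤ.* v₂) ℤ.- (z₁ ℤ.- a ℤ.* u₁ ℤ.- b ℤ.* v₁) ℤ.* u₂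
          ≡ u₁ ℤ.* z₂ ℤ.- z₁ ℤ.* u₂ ℤ.- b ℤ.* (u₁ ℤ.* v₂ ℤ.- v₁ ℤ.* u₂)
        ring = ℤ-solve

    residues : Point → ℕ
    residues z = det z v %ℕ n ℕ.+ det u z %ℕ n

    divisible : ∀ X → X %ℕ n ≡ 0 → X ≡ (X /ℕ n) ℤ.* + n
    divisible X X%n≡0 =
      trans (ℤDM.a≡a%ℕn+[a/ℕn]*n X n) (trans (cong (λ t → + t ℤ.+ (X /ℕ n) ℤ.* + n) X%n≡0) (ℤP.+-identityˡ _))

    -- Otherwise e₁ and e₂ would lie in the lattice spanned by u and v, whose index n would divide 1.
    some-residue : residues e₁ ≡ 0 → residues e₂ ≡ 0 → ⊥
    some-residue res₁ res₂ = 2+k≢1 (ℕP.m*n≡1⇒m≡1 n ∣ c ∣ (sym (trans (cong ∣_∣ one≡n*c) (ℤP.abs-* (+ n) c))))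
      where
      Q : Point → Point → ℤ
      Q a b = det a b /ℕ n
      c = Q u e₂ ℤ.* Q e₁ v ℤ.- Q e₂ v ℤ.* Q u e₁
      cramer-units : ∀ u v → det u v ≡ det u e₂ ℤ.* det e₁ v ℤ.- det e₂ v ℤ.* det u e₁
      cramer-units (u₁ , u₂) (v₁ , v₂) = ring u₁ u₂ v₁ v₂
        where
        ring : ∀ u₁ u₂ v₁ v₂ → u₁ ℤ.* v₂ ℤ.- v₁ ℤ.* u₂
          ≡ (u₁ ℤ.* 1ℤ ℤ.- 0ℤ ℤ.* u₂) ℤ.* (1ℤ ℤ.* v₂ ℤ.- v₁ ℤ.* 0ℤ)
            ℤ.- (0ℤ ℤ.* v₂ ℤ.- v₁ ℤ.* 1ℤ) ℤ.* (u₁ ℤ.* 0ℤ ℤ.- 1ℤ ℤ.* u₂)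
        ring = ℤ-solve
      factor : ∀ N a b c d →
        (a ℤ.* N) ℤ.* (b ℤ.* N) ℤ.- (c ℤ.* N) ℤ.* (d ℤ.* N) ≡ N ℤ.* (N ℤ.* (a ℤ.* b ℤ.- c ℤ.* d))
      factor = ℤ-solve
      n≡n*n*c : + n ℤ.* 1ℤ ≡ + n ℤ.* (+ n ℤ.* c)
      n≡n*n*c = begin
        + n ℤ.* 1ℤ                                          ≡⟨ ℤP.*-identityʳ (+ n) ⟩
        + n                                                ≡⟨ area≡ ⟨
        det u v                                            ≡⟨ cramer-units u v ⟩
        det u e₂ ℤ.* det e₁ v ℤ.- det e₂ v ℤ.* det u e₁     ≡⟨ cong₂ (λ a b → a ℤ.* b ℤ.- det e₂ v ℤ.* det u e₁)
                                                                     (divisible (det u e₂) (ℕP.m+n≡0⇒n≡0 _ res₂))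
                                                                     (divisible (det e₁ v) (ℕP.m+n≡0⇒m≡0 _ res₁)) ⟩
        (Q u e₂ ℤ.* + n) ℤ.* (Q e₁ v ℤ.* + n) ℤ.- det e₂ v ℤ.* det u e₁
                                                           ≡⟨ cong₂ (λ a b → (Q u e₂ ℤ.* + n) ℤ.* (Q e₁ v ℤ.* + n) ℤ.- a ℤ.* b)
                                                                     (divisible (det e₂ v) (ℕP.m+n≡0⇒m≡0 _ res₂))
                                                                     (divisible (det u e₁) (ℕP.m+n≡0⇒n≡0 _ res₁)) ⟩
        (Q u e₂ ℤ.* + n) ℤ.* (Q e₁ v ℤ.* + n) ℤ.- (Q e₂ v ℤ.* + n) ℤ.* (Q u e₁ ℤ.* + n)
                                                           ≡⟨ factor (+ n) (Q u e₂) (Q e₁ v) (Q e₂ v) (Q u e₁) ⟩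
        + n ℤ.* (+ n ℤ.* c)                                ∎
        where open ≡-Reasoning
      one≡n*c : 1ℤ ≡ + n ℤ.* c
      one≡n*c = ℤP.*-cancelˡ-≡ (+ n) 1ℤ (+ n ℤ.* c) n≡n*n*c
      2+k≢1 : n ≡ 1 → ⊥
      2+k≢1 ()

    module Reduced (z : Point) =
      Parallelogram p q r area≡ (reduce z) (proj₁ (reduce-dets z)) (proj₂ (reduce-dets z))
                    (ℤDM.n%ℕd<d (det z v) n) (ℤDM.n%ℕd<d (det u z) n)

    from-reduced : ∀ z {s} → residues z ≡ suc s → InteriorPoint p q r n
    from-reduced z res with residues z ℕP.≤? n
    ... | yes s≤n = Reduced.lower-half z (subst (0 ℕ.<_) (sym res) (ℕ.s≤s ℕ.z≤n)) s≤n
    ... | no s≰n  = Reduced.upper-half z (ℕP.≰⇒> s≰n)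

    interior : InteriorPoint p q r n
    interior with residues e₁ in res₁ | residues e₂ in res₂
    ... | suc _ | _     = from-reduced e₁ res₁
    ... | zero  | suc _ = from-reduced e₂ res₂
    ... | zero  | zero  = ⊥-elim (some-residue res₁ res₂)

interior-point : ∀ p q r k → area₂ p q r ≡ + suc (suc k) → InteriorPoint p q r (suc (suc k))
interior-point = Residues.interior

inside-bounds : ∀ {p q r w α β γ} → 0ℤ ℤ.< area₂ p q r →
  area₂ w q r ≡ + α → area₂ p w r ≡ + β → area₂ p q w ≡ + γ → ∀ x y →
  lin p x y ⊓ (lin q x y ⊓ lin r x y) ≤ lin w x y × lin w x y ≤ lin p x y ⊔ (lin q x y ⊔ lin r x y)
inside-bounds {p} {q} {r} {w} 0<area α-area β-area γ-area x y =
  convex₃-⊓-≤ (nonNeg α-area) (nonNeg β-area) (nonNeg γ-area) 0<total (barycentric-values p q r w x y) ,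
  convex₃-≤-⊔ (nonNeg α-area) (nonNeg β-area) (nonNeg γ-area) 0<total (barycentric-values p q r w x y)
  where
  nonNeg : ∀ {a n} → a ≡ + n → 0ℚ ≤ ⟦ a ⟧
  nonNeg {n = n} refl = ⟦⟧-mono-≤ {0ℤ} {+ n} (ℤ.+≤+ ℕ.z≤n)
  0<total = subst (0ℚ <_) (barycentric-total p q r w) (⟦⟧-mono-< 0<area)

-- Induction on twice the area, subdividing at an interior lattice point.
positive-triangle-decomposable : ∀ fuel p q r k → area₂ p q r ≡ + k → k ℕ.< fuel → Decomposable (maxOf (p ∷ q ∷ r ∷ []))
positive-triangle-decomposable (suc fuel) p q r zero          area≡ _ = triangle-collinear p q r area≡
positive-triangle-decomposable (suc fuel) p q r (suc zero)    area≡ _ = maxOf-unimodular p q r (cong ∣_∣ area≡)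
positive-triangle-decomposable (suc fuel) p q r (suc (suc k)) area≡ n<fuel =
  decomposable-≐ star
    (positive-triangle-decomposable fuel p q w γ γ-area (smaller γ<n)
     +ᵈ positive-triangle-decomposable fuel p w r β β-area (smaller β<n)
     +ᵈ positive-triangle-decomposable fuel q r w α (trans (sym (area₂-rotate w q r)) α-area) (smaller α<n)
     -ᵈ pair-decomposable p w -ᵈ pair-decomposable q w -ᵈ pair-decomposable r w
     +ᵈ decomposable-lin w)
  where
  open InteriorPoint (interior-point p q r k area≡)
  w = point
  smaller : ∀ {m} → m ℕ.< suc (suc k) → m ℕ.< fuel
  smaller m<n = ℕP.<-≤-trans m<n (ℕP.≤-pred n<fuel)
  star : maxOf (p ∷ q ∷ r ∷ [])
       ≐ maxOf (p ∷ q ∷ w ∷ []) +ᶠ maxOf (p ∷ w ∷ r ∷ []) +ᶠ maxOf (q ∷ r ∷ w ∷ [])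
         -ᶠ maxOf (p ∷ w ∷ []) -ᶠ maxOf (q ∷ w ∷ []) -ᶠ maxOf (r ∷ w ∷ []) +ᶠ lin w
  star x y = star-subdivision {lin p x y} {lin q x y} {lin r x y} {lin w x y}
                (proj₁ (bounds x y)) (proj₂ (bounds x y))
    where
    bounds = inside-bounds {p} {q} {r} {w} {α} {β} {γ}
               (subst (0ℤ ℤ.<_) (sym area≡) (ℤ.+<+ (ℕ.s≤s ℕ.z≤n))) α-area β-area γ-area

triangle-decomposable : ∀ p q r → Decomposable (maxOf (p ∷ q ∷ r ∷ []))
triangle-decomposable p q r with area₂ p q r in area≡
... | + k      = positive-triangle-decomposable (suc k) p q r k area≡ ℕP.≤-refl
... | -[1+ k ] =
  decomposable-≐ (maxOf-swap₂ p q r [])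
    (positive-triangle-decomposable (suc (suc k)) p r q (suc k) (trans (area₂-swap p q r) (cong ℤ.-_ area≡)) ℕP.≤-refl)

-- Radon partitions of four points

record Dominated (p q r s : Point) : Set where
  constructor dominated
  field
    bound : ∀ x y → lin p x y ≤ lin q x y ⊔ (lin r x y ⊔ lin s x y)

record Crossing (p q r s : Point) : Set where
  constructor crossing
  field
    bound : ∀ x y → lin p x y ⊓ lin q x y ≤ lin r x y ⊔ lin s x y

data Radon (p₁ p₂ p₃ p₄ : Point) : Set where
  drop₁   : Dominated p₁ p₂ p₃ p₄ → Radon p₁ p₂ p₃ p₄
  drop₂   : Dominated p₂ p₁ p₃ p₄ → Radon p₁ p₂ p₃ p₄
  drop₃   : Dominated p₃ p₁ p₂ p₄ → Radon p₁ p₂ p₃ p₄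
  drop₄   : Dominated p₄ p₁ p₂ p₃ → Radon p₁ p₂ p₃ p₄
  split₁₂ : Crossing p₁ p₂ p₃ p₄ → Radon p₁ p₂ p₃ p₄
  split₁₃ : Crossing p₁ p₃ p₂ p₄ → Radon p₁ p₂ p₃ p₄
  split₁₄ : Crossing p₁ p₄ p₂ p₃ → Radon p₁ p₂ p₃ p₄

private
  0<+≤ : ∀ {a b} → 0ℚ < a → 0ℚ ≤ b → 0ℚ < a + b
  0<+≤ {a} {b} 0<a 0≤b = subst (_< a + b) (ℚP.+-identityʳ 0ℚ) (ℚP.+-mono-<-≤ 0<a 0≤b)

  ≰⇒≤0 : ∀ {a} → ¬ (0ℚ ≤ a) → a ≤ 0ℚ
  ≰⇒≤0 0≰a = ℚP.<⇒≤ (ℚP.≰⇒> 0≰a)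

module _ (p₁ p₂ p₃ p₄ : Point) {A₁ A₂ A₃ : ℚ} (0<S : 0ℚ < A₁ + A₂ + A₃)
  (rel : ∀ x y → (A₁ + A₂ + A₃) * lin p₁ x y ≡ A₁ * lin p₂ x y + A₂ * lin p₃ x y + A₃ * lin p₄ x y)
  where

  private
    p₁-inside : 0ℚ ≤ A₁ → 0ℚ ≤ A₂ → 0ℚ ≤ A₃ → Dominated p₁ p₂ p₃ p₄
    p₁-inside 0≤A₁ 0≤A₂ 0≤A₃ = dominated λ x y → convex₃-≤-⊔ 0≤A₁ 0≤A₂ 0≤A₃ 0<S (rel x y)

    p₂-inside : A₂ ≤ 0ℚ → A₃ ≤ 0ℚ → Dominated p₂ p₁ p₃ p₄
    p₂-inside A₂≤0 A₃≤0 = dominated λ x y →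
      convex₃-≤-⊔ (ℚP.<⇒≤ 0<S) (ℚP.neg-antimono-≤ A₂≤0) (ℚP.neg-antimono-≤ A₃≤0)
        (0<+≤ (0<+≤ 0<S (ℚP.neg-antimono-≤ A₂≤0)) (ℚP.neg-antimono-≤ A₃≤0))
        (rearrange (rel x y) (identity A₁ A₂ A₃ _ _ _ _))
      where
      identity : ∀ a b c l₁ l₂ l₃ l₄ → ((a + b + c) + - b + - c) * l₂
        ≡ (a + b + c) * l₁ + - b * l₃ + - c * l₄ + ((a * l₂ + b * l₃ + c * l₄) - (a + b + c) * l₁)
      identity = solve-∀ ℚ-ring

    p₃-inside : A₁ ≤ 0ℚ → A₃ ≤ 0ℚ → Dominated p₃ p₁ p₂ p₄
    p₃-inside A₁≤0 A₃≤0 = dominated λ x y →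
      convex₃-≤-⊔ (ℚP.<⇒≤ 0<S) (ℚP.neg-antimono-≤ A₁≤0) (ℚP.neg-antimono-≤ A₃≤0)
        (0<+≤ (0<+≤ 0<S (ℚP.neg-antimono-≤ A₁≤0)) (ℚP.neg-antimono-≤ A₃≤0))
        (rearrange (rel x y) (identity A₁ A₂ A₃ _ _ _ _))
      where
      identity : ∀ a b c l₁ l₂ l₃ l₄ → ((a + b + c) + - a + - c) * l₃
        ≡ (a + b + c) * l₁ + - a * l₂ + - c * l₄ + ((a * l₂ + b * l₃ + c * l₄) - (a + b + c) * l₁)
      identity = solve-∀ ℚ-ring

    p₄-inside : A₁ ≤ 0ℚ → A₂ ≤ 0ℚ → Dominated p₄ p₁ p₂ p₃
    p₄-inside A₁≤0 A₂≤0 = dominated λ x y →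
      convex₃-≤-⊔ (ℚP.<⇒≤ 0<S) (ℚP.neg-antimono-≤ A₁≤0) (ℚP.neg-antimono-≤ A₂≤0)
        (0<+≤ (0<+≤ 0<S (ℚP.neg-antimono-≤ A₁≤0)) (ℚP.neg-antimono-≤ A₂≤0))
        (rearrange (rel x y) (identity A₁ A₂ A₃ _ _ _ _))
      where
      identity : ∀ a b c l₁ l₂ l₃ l₄ → ((a + b + c) + - a + - b) * l₄
        ≡ (a + b + c) * l₁ + - a * l₂ + - b * l₃ + ((a * l₂ + b * l₃ + c * l₄) - (a + b + c) * l₁)
      identity = solve-∀ ℚ-ring

    p₁p₂-cross : A₁ ≤ 0ℚ → 0ℚ ≤ A₂ → 0ℚ ≤ A₃ → Crossing p₁ p₂ p₃ p₄
    p₁p₂-cross A₁≤0 0≤A₂ 0≤A₃ = crossing λ x y →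
      balanced-⊓-≤-⊔ (ℚP.<⇒≤ 0<S) (ℚP.neg-antimono-≤ A₁≤0) 0≤A₂ 0≤A₃
        (0<+≤ 0<S (ℚP.neg-antimono-≤ A₁≤0)) (sum A₁ A₂ A₃)
        (rearrange (sym (rel x y)) (identity A₁ A₂ A₃ _ _ _ _))
      where
      sum : ∀ a b c → a + b + c + - a ≡ b + c
      sum = solve-∀ ℚ-ring
      identity : ∀ a b c l₁ l₂ l₃ l₄ → (a + b + c) * l₁ + - a * l₂
        ≡ b * l₃ + c * l₄ + ((a + b + c) * l₁ - (a * l₂ + b * l₃ + c * l₄))
      identity = solve-∀ ℚ-ring

    p₁p₃-cross : A₂ ≤ 0ℚ → 0ℚ ≤ A₁ → 0ℚ ≤ A₃ → Crossing p₁ p₃ p₂ p₄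
    p₁p₃-cross A₂≤0 0≤A₁ 0≤A₃ = crossing λ x y →
      balanced-⊓-≤-⊔ (ℚP.<⇒≤ 0<S) (ℚP.neg-antimono-≤ A₂≤0) 0≤A₁ 0≤A₃
        (0<+≤ 0<S (ℚP.neg-antimono-≤ A₂≤0)) (sum A₁ A₂ A₃)
        (rearrange (sym (rel x y)) (identity A₁ A₂ A₃ _ _ _ _))
      where
      sum : ∀ a b c → a + b + c + - b ≡ a + c
      sum = solve-∀ ℚ-ring
      identity : ∀ a b c l₁ l₂ l₃ l₄ → (a + b + c) * l₁ + - b * l₃
        ≡ a * l₂ + c * l₄ + ((a + b + c) * l₁ - (a * l₂ + b * l₃ + c * l₄))
      identity = solve-∀ ℚ-ring

    p₁p₄-cross : A₃ ≤ 0ℚ → 0ℚ ≤ A₁ → 0ℚ ≤ A₂ → Crossing p₁ p₄ p₂ p₃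
    p₁p₄-cross A₃≤0 0≤A₁ 0≤A₂ = crossing λ x y →
      balanced-⊓-≤-⊔ (ℚP.<⇒≤ 0<S) (ℚP.neg-antimono-≤ A₃≤0) 0≤A₁ 0≤A₂
        (0<+≤ 0<S (ℚP.neg-antimono-≤ A₃≤0)) (sum A₁ A₂ A₃)
        (rearrange (sym (rel x y)) (identity A₁ A₂ A₃ _ _ _ _))
      where
      sum : ∀ a b c → a + b + c + - c ≡ a + b
      sum = solve-∀ ℚ-ring
      identity : ∀ a b c l₁ l₂ l₃ l₄ → (a + b + c) * l₁ + - c * l₄
        ≡ a * l₂ + b * l₃ + ((a + b + c) * l₁ - (a * l₂ + b * l₃ + c * l₄))
      identity = solve-∀ ℚ-ring

  -- The signs of the barycentric coordinates of p₁ with respect to p₂ p₃ p₄ give the partition.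
  radon-barycentric : Radon p₁ p₂ p₃ p₄
  radon-barycentric with 0ℚ ℚP.≤? A₁ | 0ℚ ℚP.≤? A₂ | 0ℚ ℚP.≤? A₃
  ... | yes 0≤A₁ | yes 0≤A₂ | yes 0≤A₃ = drop₁ (p₁-inside 0≤A₁ 0≤A₂ 0≤A₃)
  ... | _        | no 0≰A₂  | no 0≰A₃  = drop₂ (p₂-inside (≰⇒≤0 0≰A₂) (≰⇒≤0 0≰A₃))
  ... | no 0≰A₁  | _        | no 0≰A₃  = drop₃ (p₃-inside (≰⇒≤0 0≰A₁) (≰⇒≤0 0≰A₃))
  ... | no 0≰A₁  | no 0≰A₂  | _        = drop₄ (p₄-inside (≰⇒≤0 0≰A₁) (≰⇒≤0 0≰A₂))
  ... | no 0≰A₁  | yes 0≤A₂ | yes 0≤A₃ = split₁₂ (p₁p₂-cross (≰⇒≤0 0≰A₁) 0≤A₂ 0≤A₃)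
  ... | yes 0≤A₁ | no 0≰A₂  | yes 0≤A₃ = split₁₃ (p₁p₃-cross (≰⇒≤0 0≰A₂) 0≤A₁ 0≤A₃)
  ... | yes 0≤A₁ | yes 0≤A₂ | no 0≰A₃  = split₁₄ (p₁p₄-cross (≰⇒≤0 0≰A₃) 0≤A₁ 0≤A₂)

module _ (p₁ p₂ p₃ p₄ : Point) where
  private
    A₁ A₂ A₃ : ℚ
    A₁ = ⟦ area₂ p₁ p₃ p₄ ⟧
    A₂ = ⟦ area₂ p₂ p₁ p₄ ⟧
    A₃ = ⟦ area₂ p₂ p₃ p₁ ⟧

    weaken : ∀ q r s → (∀ x y → lin q x y ≤ lin r x y ⊔ lin s x y) → Dominated q p₁ r s
    weaken q r s q-redundant = dominated λ x y →
      ℚP.≤-trans (q-redundant x y) (ℚP.p≤q⊔p (lin p₁ x y) (lin r x y ⊔ lin s x y))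

  radon : Radon p₁ p₂ p₃ p₄
  radon with ℤP.<-cmp 0ℤ (area₂ p₂ p₃ p₄)
  ... | tri< 0<area _ _ =
    radon-barycentric p₁ p₂ p₃ p₄ {A₁} {A₂} {A₃}
      (subst (0ℚ <_) (barycentric-total p₂ p₃ p₄ p₁) (⟦⟧-mono-< 0<area))
      (barycentric-values p₂ p₃ p₄ p₁)
  ... | tri> _ _ area<0 =
    radon-barycentric p₁ p₂ p₃ p₄ { - A₁} { - A₂} { - A₃}
      (subst (0ℚ <_) (trans (cong -_ (barycentric-total p₂ p₃ p₄ p₁)) (negate A₁ A₂ A₃))
                     (ℚP.neg-antimono-< (⟦⟧-mono-< area<0)))
      (λ x y → rearrange (barycentric-values p₂ p₃ p₄ p₁ x y) (identity A₁ A₂ A₃ _ _ _ _))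
    where
    negate : ∀ a b c → - (a + b + c) ≡ - a + - b + - c
    negate = solve-∀ ℚ-ring
    identity : ∀ a b c l₁ l₂ l₃ l₄ → (- a + - b + - c) * l₁
      ≡ - a * l₂ + - b * l₃ + - c * l₄ + ((a * l₂ + b * l₃ + c * l₄) - (a + b + c) * l₁)
    identity = solve-∀ ℚ-ring
  ... | tri≈ _ collinear _ with collinear-redundant p₂ p₃ p₄ (sym collinear)
  ...   | inj₁ p₂-redundant        = drop₂ (weaken p₂ p₃ p₄ p₂-redundant)
  ...   | inj₂ (inj₁ p₃-redundant) = drop₃ (weaken p₃ p₂ p₄ p₃-redundant)
  ...   | inj₂ (inj₂ p₄-redundant) = drop₄ (weaken p₄ p₂ p₃ p₄-redundant)

private
  dominated-≤ : ∀ {p q r s} L → Dominated p q r s → ∀ x y → lin p x y ≤ maxOf (q ∷ r ∷ s ∷ L) x y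
  dominated-≤ {p} {q} {r} {s} L (dominated bound) x y =
    ℚP.≤-trans (bound x y)
      (ℚP.⊔-mono-≤ (ℚP.≤-refl {lin q x y}) (ℚP.⊔-mono-≤ (ℚP.≤-refl {lin r x y}) (maxOf-head s L x y)))

  crossing-≤ : ∀ {p q r s} L → Crossing p q r s → ∀ x y → lin p x y ⊓ lin q x y ≤ maxOf (r ∷ s ∷ L) x y
  crossing-≤ {p} {q} {r} {s} L (crossing bound) x y =
    ℚP.≤-trans (bound x y) (ℚP.⊔-mono-≤ (ℚP.≤-refl {lin r x y}) (maxOf-head s L x y))

mutual
  maxOf₃₊-decomposable : ∀ p₁ p₂ p₃ L → Decomposable (maxOf (p₁ ∷ p₂ ∷ p₃ ∷ L))
  maxOf₃₊-decomposable p₁ p₂ p₃ []       = triangle-decomposable p₁ p₂ p₃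
  maxOf₃₊-decomposable p₁ p₂ p₃ (p₄ ∷ L) with radon p₁ p₂ p₃ p₄
  ... | drop₁ h = decomposable-≐ (maxOf-drop p₁ (p₂ ∷ p₃ ∷ p₄ ∷ L) (dominated-≤ L h))
                                 (maxOf₃₊-decomposable p₂ p₃ p₄ L)
  ... | drop₂ h = decomposable-≐ (maxOf-swap p₁ p₂ (p₃ ∷ p₄ ∷ L)
                                   ⟨≐⟩ maxOf-drop p₂ (p₁ ∷ p₃ ∷ p₄ ∷ L) (dominated-≤ L h))
                                 (maxOf₃₊-decomposable p₁ p₃ p₄ L)
  ... | drop₃ h = decomposable-≐ (maxOf-swap₂ p₁ p₂ p₃ (p₄ ∷ L) ⟨≐⟩ maxOf-swap p₁ p₃ (p₂ ∷ p₄ ∷ L)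
                                   ⟨≐⟩ maxOf-drop p₃ (p₁ ∷ p₂ ∷ p₄ ∷ L) (dominated-≤ L h))
                                 (maxOf₃₊-decomposable p₁ p₂ p₄ L)
  ... | drop₄ h = decomposable-≐ (maxOf-swap₃ p₁ p₂ p₃ p₄ L ⟨≐⟩ maxOf-swap₂ p₁ p₂ p₄ (p₃ ∷ L)
                                   ⟨≐⟩ maxOf-swap p₁ p₄ (p₂ ∷ p₃ ∷ L)
                                   ⟨≐⟩ maxOf-drop p₄ (p₁ ∷ p₂ ∷ p₃ ∷ L) (dominated-≤ L h))
                                 (maxOf₃₊-decomposable p₁ p₂ p₃ L)
  ... | split₁₂ h = decomposable-≐ (maxOf-split p₁ p₂ (p₃ ∷ p₄ ∷ L) (crossing-≤ L h))
                      (maxOf₃₊-decomposable p₂ p₃ p₄ L +ᵈ maxOf₃₊-decomposable p₁ p₃ p₄ L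
                        -ᵈ maxOf₂₊-decomposable p₃ p₄ L)
  ... | split₁₃ h = decomposable-≐ (maxOf-swap₂ p₁ p₂ p₃ (p₄ ∷ L)
                                     ⟨≐⟩ maxOf-split p₁ p₃ (p₂ ∷ p₄ ∷ L) (crossing-≤ L h))
                      (maxOf₃₊-decomposable p₃ p₂ p₄ L +ᵈ maxOf₃₊-decomposable p₁ p₂ p₄ L
                        -ᵈ maxOf₂₊-decomposable p₂ p₄ L)
  ... | split₁₄ h = decomposable-≐ (maxOf-swap₃ p₁ p₂ p₃ p₄ L ⟨≐⟩ maxOf-swap₂ p₁ p₂ p₄ (p₃ ∷ L)
                                     ⟨≐⟩ maxOf-split p₁ p₄ (p₂ ∷ p₃ ∷ L) (crossing-≤ L h))
                      (maxOf₃₊-decomposable p₄ p₂ p₃ L +ᵈ maxOf₃₊-decomposable p₁ p₂ p₃ L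
                        -ᵈ maxOf₂₊-decomposable p₂ p₃ L)

  maxOf₂₊-decomposable : ∀ p q L → Decomposable (maxOf (p ∷ q ∷ L))
  maxOf₂₊-decomposable p q []      = pair-decomposable p q
  maxOf₂₊-decomposable p q (r ∷ L) = maxOf₃₊-decomposable p q r L

maxOf-decomposable : ∀ P → Decomposable (maxOf P)
maxOf-decomposable (p ∷ [])    = decomposable-lin p
maxOf-decomposable (p ∷ q ∷ L) = maxOf₂₊-decomposable p q L

corollary7 : (P′ P″ : List⁺ Point) →
    Σ Point λ ab₀ → Σ ℤ λ kx → Σ ℤ λ ky → Σ (List (ℤ × Triangle)) λ S →
      All (λ kT → InTuni (proj₂ kT)) S ×
      ((x y : ℚ) →
        maxOf P′ x y - maxOf P″ x y
          ≡ lin ab₀ x y + ⟦ kx ⟧ * (0ℚ ⊔ x) + ⟦ ky ⟧ * (0ℚ ⊔ y) + triSum S x y)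
corollary7 P′ P″ with maxOf-decomposable P′ -ᵈ maxOf-decomposable P″
... | decomposition ab₀ kx ky S all-Tuni expand = ab₀ , kx , ky , S , all-Tuni , expand
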